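{- For every positive integer $r$, as formal power series in $q$, \[\sum_{n=0}^{\infty}\sigma_r\overline{\mathrm{mex}}(n)\,q^n = \frac{(-q;q)_\infty\,(q^{2r};q^{2r})_\infty}{(q;q)_\infty\,(q^{r};q^{2r})_\infty}.\]
   Context: $(a;q)_\infty=\prod_{j\ge 0}(1-aq^j)$. An overpartition of $n$ is a non-increasing sequence of positive integers summing to $n$ in which the first occurrence of each distinct part may be overlined (the empty overpartition is the unique overpartition of $0$). For a positive integer $r$ and an overpartition $\pi$, the least $r$-gap $\overline{\mathrm{mex}}_r(\pi)$ is the smallest positive integer that appears fewer than $r$ times among the non-overlined parts of $\pi$. Then $\sigma_r\overline{\mathrm{mex}}(n)=\sum_{\pi}\overline{\mathrm{mex}}_r(\pi)$, summed over all overpartitions $\pi$ of $n$. -}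

module Defs where

open import Data.Nat as ℕ using (ℕ; zero; suc; _≤_; _<_; _<ᵇ_; _≡ᵇ_)
open import Data.Integer as ℤ using (ℤ; +_; -_; _-_)
open import Data.Bool using (Bool; true; false; if_then_else_)
open import Data.Product using (_×_; _,_; proj₁; proj₂)
open import Data.List using (List; []; _∷_; map; concatMap; filter; length; upTo)
open import Relation.Binary.PropositionalEquality using (_≡_)
open import Relation.Nullary using (Dec; yes; no; ¬_)
open import Relation.Nullary.Decidable using (_×-dec_; _→-dec_)
import Data.Bool.Properties as BP

-- A part is (value , overlined?)
Part : Set
Part = ℕ × Bool

-- Among parts with equal value, only the first one may be overlined.
-- (This is a canonical listing: an overpartition corresponds to exactly one such list.)
data Sorted : List Part → Set where
  []  : Sorted []
  [_] : ∀ p → Sorted (p ∷ [])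
  cons : ∀ p p' {ps} →
         proj₁ p' ≤ proj₁ p →
         (proj₁ p' ≡ proj₁ p → proj₂ p' ≡ false) →
         Sorted (p' ∷ ps) → Sorted (p ∷ p' ∷ ps)

data AllPositive : List Part → Set where
  []  : AllPositive []
  _∷_ : ∀ {p ps} → 1 ≤ proj₁ p → AllPositive ps → AllPositive (p ∷ ps)

partSum : List Part → ℕ
partSum []       = 0
partSum (p ∷ ps) = proj₁ p ℕ.+ partSum ps

IsOverpartition : ℕ → List Part → Set
IsOverpartition n π = AllPositive π × Sorted π × partSum π ≡ n

sorted? : ∀ π → Dec (Sorted π)
sorted? [] = yes []
sorted? (p ∷ []) = yes [ p ]
sorted? (p ∷ p' ∷ ps) with proj₁ p' ℕ.≤? proj₁ p
                         | (proj₁ p' ℕ.≟ proj₁ p) →-dec (proj₂ p' BP.≟ false)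
                         | sorted? (p' ∷ ps)
... | yes a | yes b | yes c = yes (cons p p' a b c)
... | no ¬a | _ | _ = no λ { (cons _ _ a _ _) → ¬a a }
... | _ | no ¬b | _ = no λ { (cons _ _ _ b _) → ¬b b }
... | _ | _ | no ¬c = no λ { (cons _ _ _ _ c) → ¬c c }

allPositive? : ∀ π → Dec (AllPositive π)
allPositive? [] = yes []
allPositive? (p ∷ ps) with 1 ℕ.≤? proj₁ p | allPositive? ps
... | yes a | yes b = yes (a ∷ b)
... | no ¬a | _ = no λ { (a ∷ _) → ¬a a }
... | _ | no ¬b = no λ { (_ ∷ b) → ¬b b }

isOverpartition? : ∀ n π → Dec (IsOverpartition n π)
isOverpartition? n π = allPositive? π ×-dec (sorted? π ×-dec (partSum π ℕ.≟ n))

listsUpTo : {X : Set} → List X → ℕ → List (List X)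
listsUpTo A zero    = [] ∷ []
listsUpTo A (suc m) = [] ∷ concatMap (λ a → map (a ∷_) (listsUpTo A m)) A

partsUpTo : ℕ → List Part
partsUpTo n = concatMap (λ k → (suc k , false) ∷ (suc k , true) ∷ []) (upTo n)

-- The (finite, duplicate-free) list of all overpartitions of n:
-- every overpartition of n has at most n parts, each of size ≤ n.
overpartitions : ℕ → List (List Part)
overpartitions n = filter (isOverpartition? n) (listsUpTo (partsUpTo n) n)

countNonOver : ℕ → List Part → ℕ
countNonOver k [] = 0
countNonOver k ((v , false) ∷ ps) = (if v ≡ᵇ k then 1 else 0) ℕ.+ countNonOver k ps
countNonOver k ((v , true)  ∷ ps) = countNonOver k ps

-- Search k = start, start+1, ... ; fuel (length π + 1) always suffices
-- when r ≥ 1, since some k ∈ {1..length π + 1} does not occur at all.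
mexSearch : ℕ → List Part → ℕ → ℕ → ℕ
mexSearch r π k zero       = k
mexSearch r π k (suc fuel) =
  if countNonOver k π <ᵇ r then k else mexSearch r π (suc k) fuel

mexbar : ℕ → List Part → ℕ
mexbar r π = mexSearch r π 1 (suc (length π))

sumℕ : List ℕ → ℕ
sumℕ [] = 0
sumℕ (x ∷ xs) = x ℕ.+ sumℕ xs

σmexbar : ℕ → ℕ → ℕ
σmexbar r n = sumℕ (map (mexbar r) (overpartitions n))

Series : Set
Series = ℕ → ℤ

one : Series
one zero    = + 1
one (suc _) = + 0

_⊛_ : Series → Series → Series
(f ⊛ g) n = go n
  where
  go : ℕ → ℤ
  go zero    = f 0 ℤ.* g n
  go (suc i) = go i ℤ.+ f (suc i) ℤ.* g (n ℕ.∸ suc i)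

-- the series 1 + c q^d  (used with d ≥ 1)
binom : ℤ → ℕ → Series
binom c d n = if n ≡ᵇ 0 then + 1 else (if n ≡ᵇ d then c else + 0)

-- (s q^a ; q^b)_∞ = ∏_{j ≥ 0} (1 - s q^(a + b j)), with a, b ≥ 1.
-- Its n-th coefficient equals that of the finite product over j ≤ n,
-- since remaining factors have exponent > n.
finPoch : ℤ → ℕ → ℕ → ℕ → Series
finPoch s a b zero    = one
finPoch s a b (suc j) = finPoch s a b j ⊛ binom (- s) (a ℕ.+ b ℕ.* j)

poch : ℤ → ℕ → ℕ → Series
poch s a b n = finPoch s a b (suc n) n

-- Division N / D of formal power series, for D with constant term 1:
-- h n = N n - Σ_{i=1}^{n} D i * h (n - i).
private
  dot : Series → ℕ → List ℤ → ℤ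
  dot D i [] = + 0
  dot D i (x ∷ xs) = D i ℤ.* x ℤ.+ dot D (suc i) xs

  -- divList N D n = [h n , h (n-1) , ... , h 0]
  divList : Series → Series → ℕ → List ℤ
  divList N D zero    = N 0 ∷ []
  divList N D (suc n) = let prev = divList N D n in
                        (N (suc n) - dot D 1 prev) ∷ prev

  headOr0 : List ℤ → ℤ
  headOr0 [] = + 0
  headOr0 (x ∷ _) = x

_⊘_ : Series → Series → Series
(N ⊘ D) n = headOr0 (divList N D n)

-- The least r-gap of π exceeds k exactly when each of 1, …, k occurs at least r times
-- non-overlined, so σ_r mex(n) counts the pairs (π, k) with this property.  Deleting r plain
-- copies of each of 1, …, k matches these pairs with all overpartitions of n - r k(k+1)/2,
-- whence the generating function is (-q;q)_∞ / (q;q)_∞ · Σ_{k ≥ 0} q^{r k(k+1)/2}.  Gauss's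
-- identity Σ_{k ≥ 0} Q^{k(k+1)/2} = (Q²;Q²)_∞ / (Q;Q²)_∞ at Q = q^r finishes the proof.
-- Here the matching is realised by recursion on the largest admissible part, and Gauss's
-- identity is read off, to precision Q^{N+1}, from the centre of the finite Jacobi triple
-- product Σ_i [n choose i]_Q Q^{(i-M)(i-M+1)/2} = (-Q;Q)_{n-M} (-1;Q)_M; all infinite
-- products are compared coefficientwise through finite truncations.

module Submission where

open import Defs
open import Data.Nat as ℕ using (ℕ; zero; suc; _∸_; _≤_; _<_; z≤n; s≤s; _*_; _≡ᵇ_; _<ᵇ_)
import Data.Nat.Properties as ℕP
import Data.Nat.Tactic.RingSolver as NS
open import Data.Integer as ℤ using (ℤ; +_; -_)
import Data.Integer.Properties as ℤP
open import Data.Integer.Tactic.RingSolver using (solve-∀)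
open import Data.Bool using (true; false; if_then_else_)
open import Data.Product using (_×_; _,_; proj₁; proj₂; ∃)
open import Data.Sum using (inj₁; inj₂)
open import Data.Empty using (⊥-elim)
open import Data.Maybe using (Maybe; just; nothing)
open import Data.List using (List; []; _∷_; _++_; map; length; concatMap; upTo)
open import Data.List.Relation.Unary.All as All using (All) renaming ([] to []ᴬ; _∷_ to _∷ᴬ_)
open import Data.List.Relation.Unary.Any as Any using (here; there)
open import Data.List.Membership.Propositional using (_∈_; find)
import Data.List.Membership.Propositional.Properties as MP
open import Data.List.Relation.Unary.Unique.Propositional using (Unique)
import Data.List.Relation.Unary.Unique.Propositional.Properties as UP
open import Data.List.Relation.Unary.AllPairs using () renaming ([] to []ᴾ; _∷_ to _∷ᴾ_)
import Data.List.Properties as LP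
open import Relation.Binary.PropositionalEquality hiding ([_])
open import Relation.Nullary using (¬_; Dec; yes; no)
open import Algebra.Bundles using (CommutativeRing; RawRing)
import Algebra.Solver.Ring.AlmostCommutativeRing as ACR
open import Level using (0ℓ)
open import Function using (_∘_)
open import Function.Bundles using (mk⇔)
open import Data.List.Membership.Propositional.Properties.WithK using (unique∧set⇒bag)
open import Data.List.Relation.Binary.BagAndSetEquality using (∼bag⇒↭)
import Data.List.Relation.Binary.Permutation.Propositional.Properties as ↭
open import Data.Nat.ListAction using (sum)
open import Data.Nat.ListAction.Properties using (sum-↭)

sumTo : ℕ → (ℕ → ℤ) → ℤ
sumTo zero F = F 0
sumTo (suc n) F = sumTo n F ℤ.+ F (suc n)

sum-cong : ∀ n {F G : ℕ → ℤ} → (∀ j → j ≤ n → F j ≡ G j) → sumTo n F ≡ sumTo n G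
sum-cong zero e = e 0 z≤n
sum-cong (suc n) e = cong₂ ℤ._+_ (sum-cong n (λ j p → e j (ℕP.m≤n⇒m≤1+n p))) (e (suc n) ℕP.≤-refl)

sum-distrib-+ : ∀ n F G → sumTo n (λ j → F j ℤ.+ G j) ≡ sumTo n F ℤ.+ sumTo n G
sum-distrib-+ zero F G = refl
sum-distrib-+ (suc n) F G =
  trans (cong (ℤ._+ (F (suc n) ℤ.+ G (suc n))) (sum-distrib-+ n F G))
        (+-interchange (sumTo n F) (sumTo n G) (F (suc n)) (G (suc n)))
  where
  +-interchange : ∀ a b c d → (a ℤ.+ b) ℤ.+ (c ℤ.+ d) ≡ (a ℤ.+ c) ℤ.+ (b ℤ.+ d)
  +-interchange = solve-∀

*-distribˡ-sum : ∀ n c F → c ℤ.* sumTo n F ≡ sumTo n (λ j → c ℤ.* F j)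
*-distribˡ-sum zero c F = refl
*-distribˡ-sum (suc n) c F =
  trans (ℤP.*-distribˡ-+ c _ _) (cong (ℤ._+ (c ℤ.* F (suc n))) (*-distribˡ-sum n c F))

*-distribʳ-sum : ∀ n c F → sumTo n F ℤ.* c ≡ sumTo n (λ j → F j ℤ.* c)
*-distribʳ-sum n c F =
  trans (ℤP.*-comm _ c) (trans (*-distribˡ-sum n c F) (sum-cong n (λ j _ → ℤP.*-comm c (F j))))

sum-sucˡ : ∀ n F → sumTo (suc n) F ≡ F 0 ℤ.+ sumTo n (λ j → F (suc j))
sum-sucˡ zero F = refl
sum-sucˡ (suc n) F =
  trans (cong (ℤ._+ F (suc (suc n))) (sum-sucˡ n F))
        (ℤP.+-assoc (F 0) (sumTo n (λ j → F (suc j))) (F (suc (suc n))))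

sum-reverse : ∀ n F → sumTo n F ≡ sumTo n (λ j → F (n ∸ j))
sum-reverse zero F = refl
sum-reverse (suc n) F =
  trans (cong (ℤ._+ F (suc n)) (sum-reverse n F))
        (trans (ℤP.+-comm (sumTo n (λ j → F (n ∸ j))) (F (suc n)))
               (sym (sum-sucˡ n (λ j → F (suc n ∸ j)))))

sum-zero : ∀ n {F} → (∀ j → j ≤ n → F j ≡ + 0) → sumTo n F ≡ + 0
sum-zero zero e = e 0 z≤n
sum-zero (suc n) e = cong₂ ℤ._+_ (sum-zero n (λ j p → e j (ℕP.m≤n⇒m≤1+n p))) (e (suc n) ℕP.≤-refl)

sum-single : ∀ n k {F} → k ≤ n → (∀ j → j ≤ n → j ≢ k → F j ≡ + 0) → sumTo n F ≡ F k
sum-single zero zero z≤n e = refl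
sum-single (suc n) k {F} p e with k ℕP.≟ suc n
... | yes refl =
  trans (cong (ℤ._+ F (suc n)) (sum-zero n (λ j q → e j (ℕP.m≤n⇒m≤1+n q) (ℕP.<⇒≢ (s≤s q)))))
        (ℤP.+-identityˡ _)
... | no k≢ =
  trans (cong₂ ℤ._+_ (sum-single n k (ℕP.≤-pred (ℕP.≤∧≢⇒< p k≢)) (λ j q → e j (ℕP.m≤n⇒m≤1+n q)))
                     (e (suc n) ℕP.≤-refl (k≢ ∘ sym)))
        (ℤP.+-identityʳ _)

sum-swap-triangle : ∀ n (F : ℕ → ℕ → ℤ) →
  sumTo n (λ i → sumTo (n ∸ i) (F i)) ≡ sumTo n (λ k → sumTo k (λ i → F i (k ∸ i)))
sum-swap-triangle zero F = refl
sum-swap-triangle (suc n) F = begin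
    sumTo n (λ i → sumTo (suc n ∸ i) (F i)) ℤ.+ sumTo (n ∸ n) (F (suc n))
  ≡⟨ cong₂ ℤ._+_ (sum-cong n (λ i p → cong (λ m → sumTo m (F i)) (ℕP.+-∸-assoc 1 p)))
                 (cong (λ m → sumTo m (F (suc n))) (ℕP.n∸n≡0 n)) ⟩
    sumTo n (λ i → sumTo (n ∸ i) (F i) ℤ.+ F i (suc (n ∸ i))) ℤ.+ F (suc n) 0
  ≡⟨ cong (ℤ._+ F (suc n) 0) (sum-distrib-+ n _ _) ⟩
    (inner ℤ.+ diagonal) ℤ.+ F (suc n) 0
  ≡⟨ ℤP.+-assoc inner diagonal _ ⟩
    inner ℤ.+ (diagonal ℤ.+ F (suc n) 0)
  ≡⟨ cong₂ ℤ._+_ (sum-swap-triangle n F)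
       (cong₂ ℤ._+_ (sum-cong n (λ i p → cong (F i) (sym (ℕP.+-∸-assoc 1 p))))
                    (cong (F (suc n)) (sym (ℕP.n∸n≡0 n)))) ⟩
    sumTo n (λ k → sumTo k (λ i → F i (k ∸ i))) ℤ.+ sumTo (suc n) (λ i → F i (suc n ∸ i))
  ∎
  where
  open ≡-Reasoning
  inner diagonal : ℤ
  inner = sumTo n (λ i → sumTo (n ∸ i) (F i))
  diagonal = sumTo n (λ i → F i (suc (n ∸ i)))

sumBelow : ℕ → (ℕ → ℕ) → ℕ
sumBelow zero F = 0
sumBelow (suc n) F = F 0 ℕ.+ sumBelow n (F ∘ suc)

sumBelow-cong : ∀ n {F G} → (∀ j → j < n → F j ≡ G j) → sumBelow n F ≡ sumBelow n G
sumBelow-cong zero e = refl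
sumBelow-cong (suc n) e = cong₂ ℕ._+_ (e 0 (s≤s z≤n)) (sumBelow-cong n (λ j p → e (suc j) (s≤s p)))

sumBelow-zero : ∀ n {F} → (∀ j → j < n → F j ≡ 0) → sumBelow n F ≡ 0
sumBelow-zero zero e = refl
sumBelow-zero (suc n) e = cong₂ ℕ._+_ (e 0 (s≤s z≤n)) (sumBelow-zero n (λ j p → e (suc j) (s≤s p)))

sumBelow-distrib-+ : ∀ n F G → sumBelow n (λ j → F j ℕ.+ G j) ≡ sumBelow n F ℕ.+ sumBelow n G
sumBelow-distrib-+ zero F G = refl
sumBelow-distrib-+ (suc n) F G =
  trans (cong (F 0 ℕ.+ G 0 ℕ.+_) (sumBelow-distrib-+ n (F ∘ suc) (G ∘ suc)))
        (+-interchange (F 0) (G 0) (sumBelow n (F ∘ suc)) (sumBelow n (G ∘ suc)))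
  where
  +-interchange : ∀ a b c d → a ℕ.+ b ℕ.+ (c ℕ.+ d) ≡ a ℕ.+ c ℕ.+ (b ℕ.+ d)
  +-interchange = NS.solve-∀

sumBelow-extend : ∀ c d F → (∀ j → c ≤ j → F j ≡ 0) → sumBelow (c ℕ.+ d) F ≡ sumBelow c F
sumBelow-extend zero d F e = sumBelow-zero d (λ j _ → e j z≤n)
sumBelow-extend (suc c) d F e = cong (F 0 ℕ.+_) (sumBelow-extend c d (F ∘ suc) (λ j p → e (suc j) (s≤s p)))

≤-sumBelow : ∀ k F → (∀ j → j < k → 1 ≤ F j) → k ≤ sumBelow k F
≤-sumBelow zero F e = z≤n
≤-sumBelow (suc k) F e = ℕP.+-mono-≤ (e 0 (s≤s z≤n)) (≤-sumBelow k (F ∘ suc) (λ j p → e (suc j) (s≤s p)))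

+-sumBelow≡sumTo : ∀ n F → + sumBelow (suc n) F ≡ sumTo n (λ k → + F k)
+-sumBelow≡sumTo zero F = cong +_ (ℕP.+-identityʳ (F 0))
+-sumBelow≡sumTo (suc n) F =
  trans (cong (ℤ._+_ (+ F 0)) (+-sumBelow≡sumTo n (F ∘ suc))) (sym (sum-sucˡ n (λ k → + F k)))

cauchy : Series → Series → Series
cauchy f g n = sumTo n (λ j → f j ℤ.* g (n ∸ j))

-- Defs computes f ⊛ g with a local, unnameable helper; abstracting the outer index with
-- `with` exposes its recursion, and the helper's statement is left for Agda to infer.
mutual
  ⊛-cauchy : ∀ f g → f ⊛ g ≗ cauchy f g
  ⊛-cauchy f g zero = refl
  ⊛-cauchy f g (suc m) with suc m
  ... | N with f N ℤ.* g (m ∸ m)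
  ...   | Y = ⊛-cauchy-prefix f g N m Y

  ⊛-cauchy-prefix : ∀ (f g : Series) (N k : ℕ) (Y : ℤ) → _
  ⊛-cauchy-prefix f g N zero Y = refl
  ⊛-cauchy-prefix f g N (suc k) Y =
    cong (ℤ._+ Y) (⊛-cauchy-prefix f g N k (f (suc k) ℤ.* g (N ∸ suc k)))

infixl 6 _⊕_

_⊕_ : Series → Series → Series
(f ⊕ g) n = f n ℤ.+ g n

⊝_ : Series → Series
(⊝ f) n = ℤ.- f n

𝟘 : Series
𝟘 _ = + 0

cauchy-comm : ∀ f g → cauchy f g ≗ cauchy g f
cauchy-comm f g n = trans (sum-reverse n _) (sum-cong n (λ j p →
  trans (cong (λ m → f (n ∸ j) ℤ.* g m) (ℕP.m∸[m∸n]≡n p)) (ℤP.*-comm (f (n ∸ j)) (g j))))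

⊛-comm : ∀ f g → f ⊛ g ≗ g ⊛ f
⊛-comm f g n = trans (⊛-cauchy f g n) (trans (cauchy-comm f g n) (sym (⊛-cauchy g f n)))

⊛-cong : ∀ {f f' g g'} → f ≗ f' → g ≗ g' → f ⊛ g ≗ f' ⊛ g'
⊛-cong {f} {f'} {g} {g'} e₁ e₂ n =
  trans (vary-left g e₁ n) (trans (⊛-comm f' g n) (trans (vary-left f' e₂ n) (⊛-comm g' f' n)))
  where
  vary-left : ∀ {a a'} b → a ≗ a' → a ⊛ b ≗ a' ⊛ b
  vary-left {a} {a'} b e n =
    trans (⊛-cauchy a b n) (trans (sum-cong n (λ j _ → cong (ℤ._* b (n ∸ j)) (e j))) (sym (⊛-cauchy a' b n)))

⊛-distribˡ : ∀ f g h → f ⊛ (g ⊕ h) ≗ f ⊛ g ⊕ f ⊛ h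
⊛-distribˡ f g h n =
  trans (⊛-cauchy f _ n)
        (trans (trans (sum-cong n (λ j _ → ℤP.*-distribˡ-+ (f j) _ _)) (sum-distrib-+ n _ _))
               (sym (cong₂ ℤ._+_ (⊛-cauchy f g n) (⊛-cauchy f h n))))

⊛-distribʳ : ∀ f g h → (g ⊕ h) ⊛ f ≗ g ⊛ f ⊕ h ⊛ f
⊛-distribʳ f g h n =
  trans (⊛-comm (g ⊕ h) f n)
        (trans (⊛-distribˡ f g h n) (cong₂ ℤ._+_ (⊛-comm f g n) (⊛-comm f h n)))

⊛-identityˡ : ∀ f → one ⊛ f ≗ f
⊛-identityˡ f zero = ℤP.*-identityˡ (f 0)
⊛-identityˡ f (suc n) =
  trans (⊛-cauchy one f (suc n))
        (trans (sum-sucˡ n _)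
               (trans (cong (ℤ._+_ (ℤ.1ℤ ℤ.* f (suc n))) (sum-zero n (λ j _ → refl)))
                      (trans (ℤP.+-identityʳ _) (ℤP.*-identityˡ _))))

⊛-identityʳ : ∀ f → f ⊛ one ≗ f
⊛-identityʳ f n = trans (⊛-comm f one n) (⊛-identityˡ f n)

⊛-assoc : ∀ f g h → (f ⊛ g) ⊛ h ≗ f ⊛ (g ⊛ h)
⊛-assoc f g h n = begin
    ((f ⊛ g) ⊛ h) n
  ≡⟨ ⊛-cauchy (f ⊛ g) h n ⟩
    sumTo n (λ k → (f ⊛ g) k ℤ.* h (n ∸ k))
  ≡⟨ sum-cong n (λ k p → trans (cong (ℤ._* h (n ∸ k)) (⊛-cauchy f g k))
       (trans (*-distribʳ-sum k _ _) (sum-cong k (λ i q →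
          cong (λ m → f i ℤ.* g (k ∸ i) ℤ.* h m) (sym (∸-∸-cancel p q)))))) ⟩
    sumTo n (λ k → sumTo k (λ i → F i (k ∸ i)))
  ≡⟨ sym (sum-swap-triangle n F) ⟩
    sumTo n (λ i → sumTo (n ∸ i) (F i))
  ≡⟨ sum-cong n (λ i _ → trans (sum-cong (n ∸ i) (λ j _ → ℤP.*-assoc (f i) (g j) _))
                               (sym (*-distribˡ-sum (n ∸ i) (f i) _))) ⟩
    sumTo n (λ i → f i ℤ.* sumTo (n ∸ i) (λ j → g j ℤ.* h (n ∸ i ∸ j)))
  ≡⟨ sum-cong n (λ i _ → cong (f i ℤ.*_) (sym (⊛-cauchy g h (n ∸ i)))) ⟩
    sumTo n (λ i → f i ℤ.* (g ⊛ h) (n ∸ i))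
  ≡⟨ sym (⊛-cauchy f (g ⊛ h) n) ⟩
    (f ⊛ (g ⊛ h)) n
  ∎
  where
  open ≡-Reasoning
  F : ℕ → ℕ → ℤ
  F i j = f i ℤ.* g j ℤ.* h (n ∸ i ∸ j)
  ∸-∸-cancel : ∀ {k i} → k ≤ n → i ≤ k → n ∸ i ∸ (k ∸ i) ≡ n ∸ k
  ∸-∸-cancel {k} {i} _ q = trans (ℕP.∸-+-assoc n i (k ∸ i)) (cong (n ∸_) (ℕP.m+[n∸m]≡n q))

infix 4 _≈[_]_

_≈[_]_ : Series → ℕ → Series → Set
f ≈[ L ] g = ∀ k → k < L → f k ≡ g k

≈-refl : ∀ {f L} → f ≈[ L ] f
≈-refl k _ = refl

≈-sym : ∀ {f g L} → f ≈[ L ] g → g ≈[ L ] f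
≈-sym e k p = sym (e k p)

≈-trans : ∀ {f g h L} → f ≈[ L ] g → g ≈[ L ] h → f ≈[ L ] h
≈-trans e₁ e₂ k p = trans (e₁ k p) (e₂ k p)

≗⇒≈ : ∀ {f g L} → f ≗ g → f ≈[ L ] g
≗⇒≈ e k _ = e k

≈-weaken : ∀ {f g L M} → M ≤ L → f ≈[ L ] g → f ≈[ M ] g
≈-weaken q e k p = e k (ℕP.<-≤-trans p q)

⊛-≈ : ∀ {f f' g g' L} → f ≈[ L ] f' → g ≈[ L ] g' → f ⊛ g ≈[ L ] f' ⊛ g'
⊛-≈ {f} {f'} {g} {g'} e₁ e₂ k p =
  trans (⊛-cauchy f g k)
        (trans (sum-cong k (λ j q → cong₂ ℤ._*_ (e₁ j (ℕP.≤-<-trans q p))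
                                                 (e₂ (k ∸ j) (ℕP.≤-<-trans (ℕP.m∸n≤m k j) p))))
               (sym (⊛-cauchy f' g' k)))

⊕-≈ : ∀ {f f' g g' L} → f ≈[ L ] f' → g ≈[ L ] g' → f ⊕ g ≈[ L ] f' ⊕ g'
⊕-≈ e₁ e₂ k p = cong₂ ℤ._+_ (e₁ k p) (e₂ k p)

infix 25 q^_

q^_ : ℕ → Series
(q^ d) n = if n ≡ᵇ d then + 1 else + 0

_⊙_ : ℤ → Series → Series
(c ⊙ f) n = c ℤ.* f n

≡ᵇ-refl : ∀ n → (n ≡ᵇ n) ≡ true
≡ᵇ-refl zero = refl
≡ᵇ-refl (suc n) = ≡ᵇ-refl n

≢⇒≡ᵇ-false : ∀ m n → m ≢ n → (m ≡ᵇ n) ≡ false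
≢⇒≡ᵇ-false zero zero ne = ⊥-elim (ne refl)
≢⇒≡ᵇ-false zero (suc n) ne = refl
≢⇒≡ᵇ-false (suc m) zero ne = refl
≢⇒≡ᵇ-false (suc m) (suc n) ne = ≢⇒≡ᵇ-false m n (ne ∘ cong suc)

q^-self : ∀ d → (q^ d) d ≡ + 1
q^-self d rewrite ≡ᵇ-refl d = refl

q^-other : ∀ d n → n ≢ d → (q^ d) n ≡ + 0
q^-other d n ne rewrite ≢⇒≡ᵇ-false n d ne = refl

q^≈𝟘 : ∀ d → q^ d ≈[ d ] 𝟘
q^≈𝟘 d k p = q^-other d k (ℕP.<⇒≢ p)

q^-⊛-shift : ∀ d f m → (q^ d ⊛ f) (d ℕ.+ m) ≡ f m
q^-⊛-shift d f m =
  trans (⊛-cauchy (q^ d) f (d ℕ.+ m))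
        (trans (sum-single (d ℕ.+ m) d (ℕP.m≤m+n d m)
                  (λ j _ ne → trans (cong (ℤ._* f (d ℕ.+ m ∸ j)) (q^-other d j ne)) (ℤP.*-zeroˡ (f (d ℕ.+ m ∸ j)))))
               (trans (cong₂ ℤ._*_ (q^-self d) (cong f (ℕP.m+n∸m≡n d m))) (ℤP.*-identityˡ (f m))))

q^-⊛-below : ∀ d f n → n < d → (q^ d ⊛ f) n ≡ + 0
q^-⊛-below d f n p =
  trans (⊛-cauchy (q^ d) f n)
        (sum-zero n (λ j q → trans (cong (ℤ._* f (n ∸ j)) (q^≈𝟘 d j (ℕP.≤-<-trans q p)))
                                   (ℤP.*-zeroˡ (f (n ∸ j)))))

binom≈one : ∀ c d → binom c d ≈[ d ] one
binom≈one c d zero p = refl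
binom≈one c d (suc k) p rewrite ≢⇒≡ᵇ-false (suc k) d (ℕP.<⇒≢ p) = refl

⊛-binom≈ : ∀ f c d → f ⊛ binom c d ≈[ d ] f
⊛-binom≈ f c d = ≈-trans (⊛-≈ (≈-refl {f}) (binom≈one c d)) (≗⇒≈ (⊛-identityʳ f))

finPoch-stable : ∀ s a b → 1 ≤ a → 1 ≤ b → ∀ J t → finPoch s a b (t ℕ.+ J) ≈[ suc J ] finPoch s a b J
finPoch-stable s a b a≥1 b≥1 J zero = ≈-refl
finPoch-stable s a b a≥1 b≥1 J (suc t) =
  ≈-trans (≈-weaken exponent-large (⊛-binom≈ (finPoch s a b (t ℕ.+ J)) (- s) (a ℕ.+ b ℕ.* (t ℕ.+ J))))
          (finPoch-stable s a b a≥1 b≥1 J t)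
  where
  exponent-large : suc J ≤ a ℕ.+ b ℕ.* (t ℕ.+ J)
  exponent-large =
    ℕP.+-mono-≤ a≥1 (ℕP.≤-trans (ℕP.m≤n+m J t)
                               (ℕP.≤-trans (ℕP.≤-reflexive (sym (ℕP.*-identityˡ (t ℕ.+ J))))
                                           (ℕP.*-monoˡ-≤ (t ℕ.+ J) b≥1)))

poch≈finPoch : ∀ s a b → 1 ≤ a → 1 ≤ b → ∀ J → poch s a b ≈[ suc J ] finPoch s a b J
poch≈finPoch s a b a≥1 b≥1 J k p =
  trans (finPoch-stable s a b a≥1 b≥1 k 1 k ℕP.≤-refl)
        (sym (trans (cong (λ z → finPoch s a b z k) (sym (ℕP.m∸n+n≡m (ℕP.≤-pred p))))
                    (finPoch-stable s a b a≥1 b≥1 k (J ∸ k) k ℕP.≤-refl)))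

shiftedCauchy : Series → Series → ℕ → ℕ → ℤ
shiftedCauchy D h i zero = D i ℤ.* h 0
shiftedCauchy D h i (suc n) = D i ℤ.* h (suc n) ℤ.+ shiftedCauchy D h (suc i) n

shiftedCauchy-sum : ∀ D h i n → shiftedCauchy D h i n ≡ sumTo n (λ k → D (i ℕ.+ k) ℤ.* h (n ∸ k))
shiftedCauchy-sum D h i zero = cong (λ z → D z ℤ.* h 0) (sym (ℕP.+-identityʳ i))
shiftedCauchy-sum D h i (suc n) =
  trans (cong (ℤ._+_ (D i ℤ.* h (suc n)))
              (trans (shiftedCauchy-sum D h (suc i) n)
                     (sum-cong n (λ k _ → cong (λ z → D z ℤ.* h (n ∸ k)) (sym (ℕP.+-suc i k))))))
        (trans (cong (λ z → D z ℤ.* h (suc n) ℤ.+ sumTo n (λ k → D (i ℕ.+ suc k) ℤ.* h (n ∸ k)))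
                     (sym (ℕP.+-identityʳ i)))
               (sym (sum-sucˡ n (λ k → D (i ℕ.+ k) ℤ.* h (suc n ∸ k)))))

module _ (N D h : Series) (D₀≡1 : D 0 ≡ + 1) (h⊛D≗N : h ⊛ D ≗ N) where

  quotient-head : N 0 ≡ h 0
  quotient-head = trans (sym (h⊛D≗N 0)) (trans (cong (h 0 ℤ.*_) D₀≡1) (ℤP.*-identityʳ (h 0)))

  quotient-recurrence : ∀ n → N (suc n) ℤ.- shiftedCauchy D h 1 n ≡ h (suc n)
  quotient-recurrence n =
    trans (cong (ℤ._- S) N-expand)
          (trans (+-∸-cancel (D 0 ℤ.* h (suc n)) S)
                 (trans (cong (ℤ._* h (suc n)) D₀≡1) (ℤP.*-identityˡ (h (suc n)))))
    where
    S : ℤ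
    S = shiftedCauchy D h 1 n
    +-∸-cancel : ∀ a s → (a ℤ.+ s) ℤ.- s ≡ a
    +-∸-cancel = solve-∀
    N-expand : N (suc n) ≡ D 0 ℤ.* h (suc n) ℤ.+ S
    N-expand = trans (sym (h⊛D≗N (suc n)))
                 (trans (⊛-comm h D (suc n))
                   (trans (⊛-cauchy D h (suc n))
                     (trans (sum-sucˡ n _) (cong (ℤ._+_ (D 0 ℤ.* h (suc n))) (sym (shiftedCauchy-sum D h 1 n))))))

  -- Defs computes the quotient from the list [h n, …, h 0] with a dot product it keeps
  -- private; both are reached by unfolding, with the statements left for Agda to infer, and
  -- abstracting the literal 1 with `with` turns the start index of the dot product into a
  -- variable.
  mutual
    ⊘-unique : N ⊘ D ≗ h
    ⊘-unique zero = quotient-head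
    ⊘-unique (suc n) = trans (⊘-unfold n) (quotient-recurrence n)

    ⊘-unfold : ∀ n → _
    ⊘-unfold n with N (suc n) | 1
    ... | A | i = ⊘-dot n i A

    ⊘-dot : ∀ n i (A : ℤ) → A ℤ.+ ℤ.- _ ≡ A ℤ.+ ℤ.- shiftedCauchy D h i n
    ⊘-dot zero i A = cong (λ z → A ℤ.+ ℤ.- z) (trans (ℤP.+-identityʳ _) (cong (D i ℤ.*_) quotient-head))
    ⊘-dot (suc n) i A rewrite ⊘-dot n 1 (N (suc n)) =
      trans (cong (ℤ._+_ A) (ℤP.neg-distrib-+ X _))
            (trans (sym (ℤP.+-assoc A (ℤ.- X) _))
                   (trans (⊘-dot n (suc i) (A ℤ.+ ℤ.- X))
                          (trans (neg-+-assoc A X (shiftedCauchy D h (suc i) n))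
                                 (cong (λ z → A ℤ.+ ℤ.- (D i ℤ.* z ℤ.+ shiftedCauchy D h (suc i) n))
                                       (quotient-recurrence n)))))
      where
      X : ℤ
      X = D i ℤ.* (N (suc n) ℤ.- shiftedCauchy D h 1 n)
      neg-+-assoc : ∀ a x s → (a ℤ.+ ℤ.- x) ℤ.+ ℤ.- s ≡ a ℤ.+ ℤ.- (x ℤ.+ s)
      neg-+-assoc = solve-∀

SeriesRing : CommutativeRing 0ℓ 0ℓ
SeriesRing = record
  { Carrier = Series ; _≈_ = _≗_ ; _+_ = _⊕_ ; _*_ = _⊛_ ; -_ = ⊝_ ; 0# = 𝟘 ; 1# = one
  ; isCommutativeRing = record
    { isRing = record
      { +-isAbelianGroup = record
        { isGroup = record
          { isMonoid = record
            { isSemigroup = record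
              { isMagma = record
                { isEquivalence = record
                  { refl = λ _ → refl ; sym = λ e n → sym (e n) ; trans = λ e₁ e₂ n → trans (e₁ n) (e₂ n) }
                ; ∙-cong = λ e₁ e₂ n → cong₂ ℤ._+_ (e₁ n) (e₂ n) }
              ; assoc = λ f g h n → ℤP.+-assoc (f n) (g n) (h n) }
            ; identity = (λ f n → ℤP.+-identityˡ (f n)) , (λ f n → ℤP.+-identityʳ (f n)) }
          ; inverse = (λ f n → ℤP.+-inverseˡ (f n)) , (λ f n → ℤP.+-inverseʳ (f n))
          ; ⁻¹-cong = λ e n → cong ℤ.-_ (e n) }
        ; comm = λ f g n → ℤP.+-comm (f n) (g n) }
      ; *-cong = λ {f} {f'} {g} {g'} → ⊛-cong {f} {f'} {g} {g'}
      ; *-assoc = ⊛-assoc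
      ; *-identity = ⊛-identityˡ , ⊛-identityʳ
      ; distrib = ⊛-distribˡ , ⊛-distribʳ }
    ; *-comm = ⊛-comm } }

⊙-⊛ : ∀ c f g → (c ⊙ f) ⊛ g ≗ c ⊙ (f ⊛ g)
⊙-⊛ c f g n =
  trans (⊛-cauchy (c ⊙ f) g n)
        (trans (sum-cong n (λ j _ → ℤP.*-assoc c (f j) (g (n ∸ j))))
               (trans (sym (*-distribˡ-sum n c _)) (cong (c ℤ.*_) (sym (⊛-cauchy f g n)))))

cst : ℤ → Series
cst c = c ⊙ one

ℤ-rawRing : RawRing 0ℓ 0ℓ
ℤ-rawRing = record
  { Carrier = ℤ ; _≈_ = _≡_ ; _+_ = ℤ._+_ ; _*_ = ℤ._*_ ; -_ = ℤ.-_ ; 0# = + 0 ; 1# = + 1 }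

SeriesACR : ACR.AlmostCommutativeRing 0ℓ 0ℓ
SeriesACR = ACR.fromCommutativeRing SeriesRing

cst-homomorphism : ℤ-rawRing ACR.-Raw-AlmostCommutative⟶ SeriesACR
cst-homomorphism = record
  { ⟦_⟧ = cst
  ; +-homo = λ a b n → ℤP.*-distribʳ-+ (one n) a b
  ; *-homo = λ a b n → trans (ℤP.*-assoc a b (one n))
       (trans (cong (a ℤ.*_) (sym (⊛-identityˡ (cst b) n))) (sym (⊙-⊛ a one (cst b) n)))
  ; -‿homo = λ a n → sym (ℤP.neg-distribˡ-* a (one n))
  ; 0-homo = λ n → ℤP.*-zeroˡ (one n)
  ; 1-homo = λ n → ℤP.*-identityˡ (one n)
  }

cst-≟ : ∀ a b → Maybe (cst a ≗ cst b)
cst-≟ a b with a ℤ.≟ b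
... | yes refl = just (λ _ → refl)
... | no _ = nothing

open import Algebra.Solver.Ring ℤ-rawRing SeriesACR cst-homomorphism cst-≟
  using (solve; _:=_; _:+_; _:*_; :-_; con)
open import Relation.Binary.Reasoning.Setoid (CommutativeRing.setoid SeriesRing)

-- The solver interprets numerals through cst, so its unit is 𝟙 = cst (+ 1) rather than one.
𝟙 : Series
𝟙 = cst (+ 1)

one≗𝟙 : one ≗ 𝟙
one≗𝟙 n = sym (ℤP.*-identityˡ (one n))

≗-refl : ∀ {f : Series} → f ≗ f
≗-refl _ = refl

≗-sym : ∀ {f g : Series} → f ≗ g → g ≗ f
≗-sym e n = sym (e n)

≗-trans : ∀ {f g h : Series} → f ≗ g → g ≗ h → f ≗ h
≗-trans e₁ e₂ n = trans (e₁ n) (e₂ n)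

≡⇒≗ : ∀ {f g : Series} → f ≡ g → f ≗ g
≡⇒≗ refl = ≗-refl

⊕-cong : ∀ {f f' g g' : Series} → f ≗ f' → g ≗ g' → f ⊕ g ≗ f' ⊕ g'
⊕-cong e₁ e₂ n = cong₂ ℤ._+_ (e₁ n) (e₂ n)

⊕-congˡ : ∀ f {g g'} → g ≗ g' → f ⊕ g ≗ f ⊕ g'
⊕-congˡ f e n = cong (ℤ._+_ (f n)) (e n)

⊕-congʳ : ∀ {f f'} g → f ≗ f' → f ⊕ g ≗ f' ⊕ g
⊕-congʳ g e n = cong (ℤ._+ g n) (e n)

⊝-cong : ∀ {f g : Series} → f ≗ g → ⊝ f ≗ ⊝ g
⊝-cong e n = cong ℤ.-_ (e n)

⊛-congˡ : ∀ f {g g'} → g ≗ g' → f ⊛ g ≗ f ⊛ g'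
⊛-congˡ f {g} {g'} = ⊛-cong {f} {f} {g} {g'} ≗-refl

⊛-congʳ : ∀ {f f'} g → f ≗ f' → f ⊛ g ≗ f' ⊛ g
⊛-congʳ {f} {f'} g e = ⊛-cong {f} {f'} {g} {g} e ≗-refl

𝟙-⊛ : ∀ f → 𝟙 ⊛ f ≗ f
𝟙-⊛ f = ≗-trans (⊛-congʳ f (≗-sym one≗𝟙)) (⊛-identityˡ f)

⊛-𝟙 : ∀ f → f ⊛ 𝟙 ≗ f
⊛-𝟙 f = ≗-trans (⊛-comm f 𝟙) (𝟙-⊛ f)

⊛-𝟘 : ∀ f → f ⊛ 𝟘 ≗ 𝟘
⊛-𝟘 f k = trans (⊛-cauchy f 𝟘 k) (sum-zero k (λ j _ → ℤP.*-zeroʳ (f j)))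

𝟘-⊛ : ∀ f → 𝟘 ⊛ f ≗ 𝟘
𝟘-⊛ f = ≗-trans (⊛-comm 𝟘 f) (⊛-𝟘 f)

⊛-vanishˡ : ∀ g {f} → f ≗ 𝟘 → f ⊛ g ≗ 𝟘
⊛-vanishˡ g e = ≗-trans (⊛-congʳ g e) (𝟘-⊛ g)

⊛-vanishʳ : ∀ f {g} → g ≗ 𝟘 → f ⊛ g ≗ 𝟘
⊛-vanishʳ f e = ≗-trans (⊛-congˡ f e) (⊛-𝟘 f)

2⊛ : ∀ f → (𝟙 ⊕ 𝟙) ⊛ f ≗ (+ 2) ⊙ f
2⊛ f = ≗-trans (⊛-congʳ f (λ k → sym (ℤP.*-distribʳ-+ (one k) (+ 1) (+ 1))))
               (≗-trans (⊙-⊛ (+ 2) one f) (λ k → cong (+ 2 ℤ.*_) (⊛-identityˡ f k)))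

2⊛-cancel-≈ : ∀ {f g L} → (𝟙 ⊕ 𝟙) ⊛ f ≈[ L ] (𝟙 ⊕ 𝟙) ⊛ g → f ≈[ L ] g
2⊛-cancel-≈ {f} {g} e k p = ℤP.*-cancelˡ-≡ (+ 2) (f k) (g k) (trans (sym (2⊛ f k)) (trans (e k p) (2⊛ g k)))

q^0 : q^ 0 ≗ 𝟙
q^0 zero = refl
q^0 (suc n) = refl

q^-+ : ∀ a b → q^ a ⊛ q^ b ≗ q^ (a ℕ.+ b)
q^-+ a b n with a ℕ.≤? n
... | no a≰n =
  trans (q^-⊛-below a (q^ b) n (ℕP.≰⇒> a≰n))
        (sym (q^-other (a ℕ.+ b) n (λ e → a≰n (subst (a ≤_) (sym e) (ℕP.m≤m+n a b)))))
... | yes a≤n =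
  trans (cong (q^ a ⊛ q^ b) (sym (ℕP.m+[n∸m]≡n a≤n)))
        (trans (q^-⊛-shift a (q^ b) (n ∸ a))
               (trans (shifted (n ∸ a)) (cong (q^ (a ℕ.+ b)) (ℕP.m+[n∸m]≡n a≤n))))
  where
  shifted : ∀ m → (q^ b) m ≡ (q^ (a ℕ.+ b)) (a ℕ.+ m)
  shifted m with m ℕP.≟ b
  ... | yes refl = trans (q^-self b) (sym (q^-self (a ℕ.+ b)))
  ... | no ne = trans (q^-other b m ne) (sym (q^-other (a ℕ.+ b) (a ℕ.+ m) (ne ∘ ℕP.+-cancelˡ-≡ a m b)))

q^-⊛-≈ : ∀ d {f g L} → f ≈[ L ] g → q^ d ⊛ f ≈[ d ℕ.+ L ] q^ d ⊛ g
q^-⊛-≈ d {f} {g} {L} e k p with d ℕ.≤? k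
... | no d≰k = trans (q^-⊛-below d f k (ℕP.≰⇒> d≰k)) (sym (q^-⊛-below d g k (ℕP.≰⇒> d≰k)))
... | yes d≤k =
  trans (cong (q^ d ⊛ f) (sym (ℕP.m+[n∸m]≡n d≤k)))
        (trans (q^-⊛-shift d f (k ∸ d))
               (trans (e (k ∸ d) below)
                      (trans (sym (q^-⊛-shift d g (k ∸ d))) (cong (q^ d ⊛ g) (ℕP.m+[n∸m]≡n d≤k)))))
  where
  below : k ∸ d < L
  below = ℕP.+-cancelˡ-< d (k ∸ d) L (subst (_< d ℕ.+ L) (sym (ℕP.m+[n∸m]≡n d≤k)) p)

infix 25 1-q^_ 1+q^_

1-q^_ : ℕ → Series
1-q^ d = 𝟙 ⊕ ⊝ q^ d

1+q^_ : ℕ → Series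
1+q^ d = 𝟙 ⊕ q^ d

1-q^≈𝟙 : ∀ d → 1-q^ d ≈[ d ] 𝟙
1-q^≈𝟙 d k p = trans (cong (λ z → 𝟙 k ℤ.+ ℤ.- z) (q^≈𝟘 d k p)) (ℤP.+-identityʳ (𝟙 k))

1+q^≈𝟙 : ∀ d → 1+q^ d ≈[ d ] 𝟙
1+q^≈𝟙 d k p = trans (cong (ℤ._+_ (𝟙 k)) (q^≈𝟘 d k p)) (ℤP.+-identityʳ (𝟙 k))

binom-1≗ : ∀ d → 1 ≤ d → binom (- (+ 1)) d ≗ 1-q^ d
binom-1≗ (suc d) _ zero = refl
binom-1≗ (suc d) _ (suc n) with n ℕP.≟ d
... | yes refl rewrite ≡ᵇ-refl n = refl
... | no ne rewrite ≢⇒≡ᵇ-false n d ne = refl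

binom+1≗ : ∀ d → 1 ≤ d → binom (+ 1) d ≗ 1+q^ d
binom+1≗ (suc d) _ zero = refl
binom+1≗ (suc d) _ (suc n) with n ℕP.≟ d
... | yes refl rewrite ≡ᵇ-refl n = refl
... | no ne rewrite ≢⇒≡ᵇ-false n d ne = refl

⊛-cancelʳ-≈ : ∀ {u v V} L → V 0 ≡ + 1 → u ⊛ V ≈[ L ] v ⊛ V → u ≈[ L ] v
⊛-cancelʳ-≈ {u} {v} {V} L V₀≡1 e k p = agree-upTo k p k ℕP.≤-refl
  where
  tail : Series → ℕ → ℤ
  tail f k = sumTo k (λ j → V (suc j) ℤ.* f (k ∸ j))
  expand : ∀ f k → (f ⊛ V) (suc k) ≡ f (suc k) ℤ.+ tail f k
  expand f k =
    trans (⊛-comm f V (suc k))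
          (trans (⊛-cauchy V f (suc k))
                 (trans (sum-sucˡ k _)
                        (cong (ℤ._+ tail f k) (trans (cong (ℤ._* f (suc k)) V₀≡1) (ℤP.*-identityˡ (f (suc k)))))))
  +-∸-cancel : ∀ a s → (a ℤ.+ s) ℤ.- s ≡ a
  +-∸-cancel = solve-∀
  agree-upTo : ∀ k → k < L → ∀ j → j ≤ k → u j ≡ v j
  agree-upTo zero p zero z≤n =
    trans (sym (ℤP.*-identityʳ (u 0)))
          (trans (cong (u 0 ℤ.*_) (sym V₀≡1))
                 (trans (e 0 p) (trans (cong (v 0 ℤ.*_) V₀≡1) (ℤP.*-identityʳ (v 0)))))
  agree-upTo (suc k) p j q with j ℕP.≟ suc k
  ... | no ne = agree-upTo k (ℕP.<⇒≤ p) j (ℕP.≤-pred (ℕP.≤∧≢⇒< q ne))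
  ... | yes refl =
    trans (sym (+-∸-cancel (u (suc k)) (tail u k)))
          (trans (cong₂ ℤ._-_ (trans (sym (expand u k)) (trans (e (suc k) p) (expand v k))) tails-agree)
                 (+-∸-cancel (v (suc k)) (tail v k)))
    where
    tails-agree : tail u k ≡ tail v k
    tails-agree = sum-cong k (λ i _ → cong (V (suc i) ℤ.*_) (agree-upTo k (ℕP.<⇒≤ p) (k ∸ i) (ℕP.m∸n≤m k i)))

⊛-cancelʳ : ∀ {u v V} → V 0 ≡ + 1 → u ⊛ V ≗ v ⊛ V → u ≗ v
⊛-cancelʳ {u} {v} {V} V₀≡1 e n = ⊛-cancelʳ-≈ {u} {v} {V} (suc n) V₀≡1 (≗⇒≈ e) n ℕP.≤-refl

-- sumS n (like sumTo n) ranges over i ≤ n, whereas prodS n ranges over i < n.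
sumS : ℕ → (ℕ → Series) → Series
sumS n F k = sumTo n (λ i → F i k)

sumS-cong : ∀ n {F G} → (∀ i → i ≤ n → F i ≗ G i) → sumS n F ≗ sumS n G
sumS-cong n e k = sum-cong n (λ i p → e i p k)

sumS-≈ : ∀ n {F G L} → (∀ i → i ≤ n → F i ≈[ L ] G i) → sumS n F ≈[ L ] sumS n G
sumS-≈ n e k p = sum-cong n (λ i q → e i q k p)

sumS-sucˡ : ∀ n F → sumS (suc n) F ≗ F 0 ⊕ sumS n (λ j → F (suc j))
sumS-sucˡ n F k = sum-sucˡ n (λ i → F i k)

sumS-distrib-⊕ : ∀ n F G → sumS n (λ i → F i ⊕ G i) ≗ sumS n F ⊕ sumS n G
sumS-distrib-⊕ n F G k = sum-distrib-+ n (λ i → F i k) (λ i → G i k)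

sumS-last-𝟘 : ∀ n F → F (suc n) ≗ 𝟘 → sumS (suc n) F ≗ sumS n F
sumS-last-𝟘 n F e k = trans (cong (ℤ._+_ (sumS n F k)) (e k)) (ℤP.+-identityʳ _)

sumS-reverse : ∀ n F → sumS n F ≗ sumS n (λ j → F (n ∸ j))
sumS-reverse n F k = sum-reverse n (λ i → F i k)

sumS-split : ∀ a b F → sumS (a ℕ.+ suc b) F ≗ sumS a F ⊕ sumS b (λ j → F (suc a ℕ.+ j))
sumS-split a zero F k =
  trans (cong (λ m → sumTo m (λ i → F i k)) (ℕP.+-comm a 1))
        (cong (λ m → sumS a F k ℤ.+ F m k) (sym (ℕP.+-identityʳ (suc a))))
sumS-split a (suc b) F k =
  trans (cong (λ m → sumTo m (λ i → F i k)) (ℕP.+-suc a (suc b)))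
        (trans (cong (ℤ._+ F (suc (a ℕ.+ suc b)) k) (sumS-split a b F k))
               (ℤP.+-assoc (sumS a F k) (sumS b (λ j → F (suc a ℕ.+ j)) k) _))

⊛-distribˡ-sumS : ∀ f n F → f ⊛ sumS n F ≗ sumS n (λ i → f ⊛ F i)
⊛-distribˡ-sumS f zero F = ≗-refl
⊛-distribˡ-sumS f (suc n) F =
  ≗-trans (⊛-distribˡ f (sumS n F) (F (suc n))) (⊕-congʳ (f ⊛ F (suc n)) (⊛-distribˡ-sumS f n F))

⊛-distribʳ-sumS : ∀ n F G → sumS n F ⊛ G ≗ sumS n (λ k → F k ⊛ G)
⊛-distribʳ-sumS n F G =
  ≗-trans (⊛-comm (sumS n F) G)
          (≗-trans (⊛-distribˡ-sumS G n F) (sumS-cong n (λ k _ → ⊛-comm G (F k))))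

prodS : ℕ → (ℕ → Series) → Series
prodS zero F = 𝟙
prodS (suc n) F = prodS n F ⊛ F n

prodS-cong : ∀ n {F G} → (∀ i → i < n → F i ≗ G i) → prodS n F ≗ prodS n G
prodS-cong zero e = ≗-refl
prodS-cong (suc n) {F} {G} e =
  ⊛-cong {prodS n F} {prodS n G} (prodS-cong n (λ i p → e i (ℕP.m≤n⇒m≤1+n p))) (e n ℕP.≤-refl)

prodS-constant : ∀ n F → (∀ i → i < n → F i 0 ≡ + 1) → prodS n F 0 ≡ + 1
prodS-constant zero F e = refl
prodS-constant (suc n) F e = cong₂ ℤ._*_ (prodS-constant n F (λ i p → e i (ℕP.m≤n⇒m≤1+n p))) (e n ℕP.≤-refl)

prodS-≈𝟙 : ∀ n {F L} → (∀ i → i < n → F i ≈[ L ] 𝟙) → prodS n F ≈[ L ] 𝟙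
prodS-≈𝟙 zero e = ≈-refl
prodS-≈𝟙 (suc n) {F} e =
  ≈-trans (⊛-≈ {prodS n F} {𝟙} (prodS-≈𝟙 n (λ i p → e i (ℕP.m≤n⇒m≤1+n p))) (e n ℕP.≤-refl))
          (≗⇒≈ (𝟙-⊛ 𝟙))

prodS-split : ∀ a b F → prodS (a ℕ.+ b) F ≗ prodS a F ⊛ prodS b (λ i → F (a ℕ.+ i))
prodS-split a zero F =
  ≗-trans (≡⇒≗ (cong (λ m → prodS m F) (ℕP.+-identityʳ a))) (≗-sym (⊛-𝟙 (prodS a F)))
prodS-split a (suc b) F = begin
    prodS (a ℕ.+ suc b) F
  ≡⟨ cong (λ m → prodS m F) (ℕP.+-suc a b) ⟩
    prodS (a ℕ.+ b) F ⊛ F (a ℕ.+ b)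
  ≈⟨ ⊛-congʳ (F (a ℕ.+ b)) (prodS-split a b F) ⟩
    (prodS a F ⊛ prodS b G) ⊛ F (a ℕ.+ b)
  ≈⟨ ⊛-assoc (prodS a F) (prodS b G) (F (a ℕ.+ b)) ⟩
    prodS a F ⊛ prodS (suc b) G
  ∎
  where
  G : ℕ → Series
  G i = F (a ℕ.+ i)

prodS-⊛ : ∀ n F G → prodS n (λ i → F i ⊛ G i) ≗ prodS n F ⊛ prodS n G
prodS-⊛ zero F G = ≗-sym (𝟙-⊛ 𝟙)
prodS-⊛ (suc n) F G = begin
    prodS n (λ i → F i ⊛ G i) ⊛ (F n ⊛ G n)
  ≈⟨ ⊛-congʳ (F n ⊛ G n) (prodS-⊛ n F G) ⟩
    (prodS n F ⊛ prodS n G) ⊛ (F n ⊛ G n)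
  ≈⟨ solve 4 (λ a b c d → (a :* b) :* (c :* d) := (a :* c) :* (b :* d)) (λ _ → refl)
             (prodS n F) (prodS n G) (F n) (G n) ⟩
    (prodS n F ⊛ F n) ⊛ (prodS n G ⊛ G n)
  ∎

prodS-pairs : ∀ N F → prodS (N ℕ.+ N) F ≗ prodS N (λ j → F (j ℕ.+ j) ⊛ F (suc (j ℕ.+ j)))
prodS-pairs zero F = ≗-refl
prodS-pairs (suc N) F = begin
    prodS (N ℕ.+ suc N) F ⊛ F (N ℕ.+ suc N)
  ≡⟨ cong (λ k → prodS k F ⊛ F k) (ℕP.+-suc N N) ⟩
    (prodS (N ℕ.+ N) F ⊛ F (N ℕ.+ N)) ⊛ F (suc (N ℕ.+ N))
  ≈⟨ ⊛-assoc (prodS (N ℕ.+ N) F) (F (N ℕ.+ N)) (F (suc (N ℕ.+ N))) ⟩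
    prodS (N ℕ.+ N) F ⊛ (F (N ℕ.+ N) ⊛ F (suc (N ℕ.+ N)))
  ≈⟨ ⊛-congʳ (F (N ℕ.+ N) ⊛ F (suc (N ℕ.+ N))) (prodS-pairs N F) ⟩
    prodS (suc N) (λ j → F (j ℕ.+ j) ⊛ F (suc (j ℕ.+ j)))
  ∎

finPoch-prodS : ∀ s a b J → finPoch s a b J ≗ prodS J (λ j → binom (- s) (a ℕ.+ b ℕ.* j))
finPoch-prodS s a b zero = one≗𝟙
finPoch-prodS s a b (suc J) = ⊛-congʳ (binom (- s) (a ℕ.+ b ℕ.* J)) (finPoch-prodS s a b J)

module _ {A : Set} where

  sumOver : (A → ℕ) → List A → ℕ
  sumOver g xs = sumℕ (map g xs)

  sumOver-++ : ∀ g xs ys → sumOver g (xs ++ ys) ≡ sumOver g xs ℕ.+ sumOver g ys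
  sumOver-++ g [] ys = refl
  sumOver-++ g (x ∷ xs) ys = trans (cong (g x ℕ.+_) (sumOver-++ g xs ys)) (sym (ℕP.+-assoc (g x) _ _))

  sumOver-map : ∀ g (h : A → A) xs → sumOver g (map h xs) ≡ sumOver (g ∘ h) xs
  sumOver-map g h [] = refl
  sumOver-map g h (x ∷ xs) = cong (g (h x) ℕ.+_) (sumOver-map g h xs)

  sumOver-cong : ∀ {g g'} xs → (∀ x → x ∈ xs → g x ≡ g' x) → sumOver g xs ≡ sumOver g' xs
  sumOver-cong [] e = refl
  sumOver-cong (x ∷ xs) e = cong₂ ℕ._+_ (e x (here refl)) (sumOver-cong xs (λ y p → e y (there p)))

  sumOver-zero : ∀ {g} xs → (∀ x → x ∈ xs → g x ≡ 0) → sumOver g xs ≡ 0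
  sumOver-zero [] e = refl
  sumOver-zero (x ∷ xs) e = cong₂ ℕ._+_ (e x (here refl)) (sumOver-zero xs (λ y p → e y (there p)))

  sumOver-sameElements : ∀ g {xs ys} → Unique xs → Unique ys →
    (∀ {z} → z ∈ xs → z ∈ ys) → (∀ {z} → z ∈ ys → z ∈ xs) → sumOver g xs ≡ sumOver g ys
  sumOver-sameElements g {xs} {ys} ux uy to from =
    trans (sumℕ≡sum (map g xs))
          (trans (sum-↭ (↭.map⁺ g (∼bag⇒↭ (unique∧set⇒bag ux uy (mk⇔ to from)))))
                 (sym (sumℕ≡sum (map g ys))))
    where
    sumℕ≡sum : ∀ ns → sumℕ ns ≡ sum ns
    sumℕ≡sum [] = refl
    sumℕ≡sum (n ∷ ns) = cong (n ℕ.+_) (sumℕ≡sum ns)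

guard : ∀ {X P : Set} → Dec P → List X → List X
guard (yes _) xs = xs
guard (no _) _ = []

∈-guard⁻ : ∀ {X P : Set} (d : Dec P) {x : X} {xs} → x ∈ guard d xs → P × x ∈ xs
∈-guard⁻ (yes p) q = p , q

∈-guard⁺ : ∀ {X P : Set} (d : Dec P) → P → {x : X} {xs : List X} → x ∈ xs → x ∈ guard d xs
∈-guard⁺ (yes _) _ q = q
∈-guard⁺ (no ¬p) p q = ⊥-elim (¬p p)

guard-unique : ∀ {X P : Set} (d : Dec P) {xs : List X} → Unique xs → Unique (guard d xs)
guard-unique (yes _) u = u
guard-unique (no _) u = []ᴾ

∈-map-∷⁻ : ∀ {X : Set} {a : X} {x : List X} {xs : List (List X)} →
  x ∈ map (a ∷_) xs → ∃ λ y → x ≡ a ∷ y × y ∈ xs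
∈-map-∷⁻ {a = a} q with MP.∈-map⁻ (a ∷_) q
... | y , p , e = y , e , p

map-∷-unique : ∀ {X : Set} (a : X) {xs} → Unique xs → Unique (map (a ∷_) xs)
map-∷-unique a = UP.map⁺ LP.∷-injectiveʳ

concatMap-unique : ∀ {X Y : Set} (f : X → List Y) xs → Unique xs → (∀ x → Unique (f x)) →
  (∀ {x x' y} → y ∈ f x → y ∈ f x' → x ≡ x') → Unique (concatMap f xs)
concatMap-unique f [] u uf inj = []ᴾ
concatMap-unique f (x ∷ xs) (x∉xs ∷ᴾ u) uf inj = UP.++⁺ (uf x) (concatMap-unique f xs u uf inj) disjoint
  where
  disjoint : ∀ {y} → ¬ (y ∈ f x × y ∈ concatMap f xs)
  disjoint (p , q) with find (MP.∈-concatMap⁻ f q)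
  ... | z , z∈xs , y∈fz with inj p y∈fz
  ...   | refl = All.lookup x∉xs z∈xs refl

listsUpTo-unique : ∀ {X : Set} (A : List X) m → Unique A → Unique (listsUpTo A m)
listsUpTo-unique A zero u = []ᴬ ∷ᴾ []ᴾ
listsUpTo-unique {X} A (suc m) u =
  All.tabulate nonempty ∷ᴾ concatMap-unique extend A u (λ a → map-∷-unique a (listsUpTo-unique A m u)) head-determined
  where
  extend : X → List (List X)
  extend a = map (a ∷_) (listsUpTo A m)
  nonempty : ∀ {y} → y ∈ concatMap extend A → [] ≢ y
  nonempty q []≡y with find (MP.∈-concatMap⁻ extend {xs = A} q)
  ... | a , _ , p = []≢∷ (trans []≡y (proj₁ (proj₂ (∈-map-∷⁻ {a = a} p))))
    where
    []≢∷ : ∀ {z : X} {zs : List X} → [] ≢ z ∷ zs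
    []≢∷ ()
  head-determined : ∀ {x x' y} → y ∈ extend x → y ∈ extend x' → x ≡ x'
  head-determined p q with MP.∈-map⁻ _ p | MP.∈-map⁻ _ q
  ... | _ , _ , refl | _ , _ , e = LP.∷-injectiveˡ e

partsUpTo-unique : ∀ n → Unique (partsUpTo n)
partsUpTo-unique n = concatMap-unique bothParts (upTo n) (UP.upTo⁺ n)
  (λ k → ((λ ()) ∷ᴬ []ᴬ) ∷ᴾ ([]ᴬ ∷ᴾ []ᴾ)) size-determined
  where
  bothParts : ℕ → List Part
  bothParts k = (suc k , false) ∷ (suc k , true) ∷ []
  size-determined : ∀ {x x' y} → y ∈ bothParts x → y ∈ bothParts x' → x ≡ x'
  size-determined (here refl) (here refl) = refl
  size-determined (here refl) (there (here ()))
  size-determined (there (here refl)) (here ())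
  size-determined (there (here refl)) (there (here refl)) = refl

PartsAtMost : ℕ → List Part → Set
PartsAtMost m π = All (λ p → proj₁ p ≤ m) π

NotOverlined : ℕ → List Part → Set
NotOverlined v π = All (λ p → proj₁ p ≡ v → proj₂ p ≡ false) π

PartsAtMost-weaken : ∀ {a b} π → a ≤ b → PartsAtMost a π → PartsAtMost b π
PartsAtMost-weaken π a≤b = All.map (λ q → ℕP.≤-trans q a≤b)

NotOverlined-above : ∀ {m} π → PartsAtMost m π → NotOverlined (suc m) π
NotOverlined-above π = All.map (λ q e → ⊥-elim (ℕP.<-irrefl e (s≤s q)))

NotOverlined-lift : ∀ {a b} ps → PartsAtMost a ps → NotOverlined a ps → a ≤ b → NotOverlined b ps
NotOverlined-lift [] _ _ _ = []ᴬ
NotOverlined-lift (q ∷ ps) (l ∷ᴬ ls) (n ∷ᴬ ns) a≤b =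
  (λ e → n (ℕP.≤-antisym l (subst (_ ≤_) (sym e) a≤b))) ∷ᴬ NotOverlined-lift ps ls ns a≤b

Sorted-tail : ∀ {p ps} → Sorted (p ∷ ps) → Sorted ps
Sorted-tail [ p ] = []
Sorted-tail (cons p p' _ _ s) = s

Sorted-head : ∀ {p ps} → Sorted (p ∷ ps) → PartsAtMost (proj₁ p) ps × NotOverlined (proj₁ p) ps
Sorted-head [ p ] = []ᴬ , []ᴬ
Sorted-head (cons p p' {ps} le eqf s) with Sorted-head s
... | le' , no' = (le ∷ᴬ All.map (λ q → ℕP.≤-trans q le) le') , (eqf ∷ᴬ NotOverlined-lift ps le' no' le)

IsOverpartition-∷ : ∀ {n v b π} → 1 ≤ v → v ≤ n → IsOverpartition (n ∸ v) π →
  PartsAtMost v π → NotOverlined v π → IsOverpartition n ((v , b) ∷ π)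
IsOverpartition-∷ {n} {v} {b} {π} v≥1 v≤n (pos , sorted , sum) le nv =
  (v≥1 ∷ pos) , sorted-∷ π sorted le nv , trans (cong (v ℕ.+_) sum) (ℕP.m+[n∸m]≡n v≤n)
  where
  sorted-∷ : ∀ π → Sorted π → PartsAtMost v π → NotOverlined v π → Sorted ((v , b) ∷ π)
  sorted-∷ [] _ _ _ = [ v , b ]
  sorted-∷ (p' ∷ ps) s (l ∷ᴬ _) (nn ∷ᴬ _) = cons (v , b) p' l nn s

IsOverpartition-uncons : ∀ {n h b π} → IsOverpartition n ((h , b) ∷ π) →
  1 ≤ h × h ≤ n × IsOverpartition (n ∸ h) π × PartsAtMost h π × NotOverlined h π
IsOverpartition-uncons {n} {h} {b} {π} (h≥1 ∷ pos , sorted , sum) =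
  h≥1 , h≤n , (pos , Sorted-tail sorted , sum-tail) , Sorted-head sorted
  where
  h≤n : h ≤ n
  h≤n = subst (h ≤_) sum (ℕP.m≤m+n h (partSum π))
  sum-tail : partSum π ≡ n ∸ h
  sum-tail = trans (sym (ℕP.m+n∸m≡n h (partSum π))) (cong (_∸ h) sum)

-- bounded m n lists the overpartitions of n with parts at most m.  plainTop m f n lists
-- those of n with parts at most m + 1, where m + 1 is never overlined and occurs at
-- most f times (the fuel f = n never runs out).
mutual
  bounded : ℕ → ℕ → List (List Part)
  bounded zero zero = [] ∷ []
  bounded zero (suc n) = []
  bounded (suc m) n =
    plainTop m n n ++ guard (suc m ℕ.≤? n) (map ((suc m , true) ∷_) (plainTop m n (n ∸ suc m)))

  plainTop : ℕ → ℕ → ℕ → List (List Part)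
  plainTop m zero n = bounded m n
  plainTop m (suc f) n =
    bounded m n ++ guard (suc m ℕ.≤? n) (map ((suc m , false) ∷_) (plainTop m f (n ∸ suc m)))

bounded⊆plainTop : ∀ m f n {π} → π ∈ bounded m n → π ∈ plainTop m f n
bounded⊆plainTop m zero n p = p
bounded⊆plainTop m (suc f) n p = MP.∈-++⁺ˡ p

mutual
  bounded-sound : ∀ m n {π} → π ∈ bounded m n → IsOverpartition n π × PartsAtMost m π
  bounded-sound zero zero (here refl) = ([] , [] , refl) , []ᴬ
  bounded-sound (suc m) n p with MP.∈-++⁻ (plainTop m n n) p
  ... | inj₁ q = let (ov , le , _) = plainTop-sound m n n q in ov , le
  ... | inj₂ q with ∈-guard⁻ (suc m ℕ.≤? n) q
  ...   | v≤n , q' with ∈-map-∷⁻ q'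
  ...     | _ , refl , q'' = let (ov , le , nv) = plainTop-sound m n (n ∸ suc m) q'' in
                IsOverpartition-∷ (s≤s z≤n) v≤n ov le nv , (ℕP.≤-refl ∷ᴬ le)

  plainTop-sound : ∀ m f n {π} → π ∈ plainTop m f n →
    IsOverpartition n π × PartsAtMost (suc m) π × NotOverlined (suc m) π
  plainTop-sound m zero n {π} p =
    let (ov , le) = bounded-sound m n p in ov , PartsAtMost-weaken π (ℕP.n≤1+n m) le , NotOverlined-above π le
  plainTop-sound m (suc f) n {π} p with MP.∈-++⁻ (bounded m n) p
  ... | inj₁ q = let (ov , le) = bounded-sound m n q in
                 ov , PartsAtMost-weaken π (ℕP.n≤1+n m) le , NotOverlined-above π le
  ... | inj₂ q with ∈-guard⁻ (suc m ℕ.≤? n) q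
  ...   | v≤n , q' with ∈-map-∷⁻ q'
  ...     | _ , refl , q'' = let (ov , le , nv) = plainTop-sound m f (n ∸ suc m) q'' in
                IsOverpartition-∷ (s≤s z≤n) v≤n ov le nv , (ℕP.≤-refl ∷ᴬ le) , ((λ _ → refl) ∷ᴬ nv)

mutual
  bounded-complete : ∀ m n π → IsOverpartition n π → PartsAtMost m π → π ∈ bounded m n
  bounded-complete zero n [] (_ , _ , refl) _ = here refl
  bounded-complete zero n ((h , b) ∷ π) ov (h≤0 ∷ᴬ _) =
    ⊥-elim (ℕP.n≮0 (ℕP.≤-trans (proj₁ (IsOverpartition-uncons ov)) h≤0))
  bounded-complete (suc m) n [] ov le = MP.∈-++⁺ˡ (bounded⊆plainTop m n n (bounded-complete m n [] ov []ᴬ))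
  bounded-complete (suc m) n ((h , b) ∷ π) ov (h≤ ∷ᴬ le) with h ℕ.≤? m | IsOverpartition-uncons ov
  ... | yes h≤m | _ , _ , _ , lh , _ =
    MP.∈-++⁺ˡ (bounded⊆plainTop m n n (bounded-complete m n _ ov (h≤m ∷ᴬ PartsAtMost-weaken π h≤m lh)))
  ... | no h≰m | _ , h≤n , ov' , lh , nh with ℕP.≤-antisym h≤ (ℕP.≰⇒> h≰m)
  ...   | refl with b
  ...     | false = MP.∈-++⁺ˡ (plainTop-complete m n n _ ov (h≤ ∷ᴬ le) ((λ _ → refl) ∷ᴬ nh) ℕP.≤-refl)
  ...     | true = MP.∈-++⁺ʳ (plainTop m n n) (∈-guard⁺ (suc m ℕ.≤? n) h≤n (MP.∈-map⁺ ((suc m , true) ∷_)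
                     (plainTop-complete m n (n ∸ suc m) π ov' lh nh (ℕP.m∸n≤m n (suc m)))))

  plainTop-complete : ∀ m f n π → IsOverpartition n π → PartsAtMost (suc m) π → NotOverlined (suc m) π →
    n ≤ f → π ∈ plainTop m f n
  plainTop-complete m f n [] ov le nv n≤f = bounded⊆plainTop m f n (bounded-complete m n [] ov []ᴬ)
  plainTop-complete m f n ((h , b) ∷ π) ov (h≤ ∷ᴬ le) (hno ∷ᴬ nv) n≤f with h ℕ.≤? m | IsOverpartition-uncons ov
  ... | yes h≤m | _ , _ , _ , lh , _ =
    bounded⊆plainTop m f n (bounded-complete m n _ ov (h≤m ∷ᴬ PartsAtMost-weaken π h≤m lh))
  ... | no h≰m | _ , h≤n , ov' , lh , nh with ℕP.≤-antisym h≤ (ℕP.≰⇒> h≰m)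
  ...   | refl with hno refl | f
  ...     | refl | zero = ⊥-elim (ℕP.n≮0 (ℕP.≤-trans h≤n n≤f))
  ...     | refl | suc f' =
    MP.∈-++⁺ʳ (bounded m n) (∈-guard⁺ (suc m ℕ.≤? n) h≤n (MP.∈-map⁺ ((suc m , false) ∷_)
      (plainTop-complete m f' (n ∸ suc m) π ov' lh nh
        (ℕP.≤-trans (ℕP.∸-monoʳ-≤ n (s≤s (z≤n {m}))) (ℕP.∸-monoˡ-≤ 1 n≤f)))))

mutual
  bounded-unique : ∀ m n → Unique (bounded m n)
  bounded-unique zero zero = []ᴬ ∷ᴾ []ᴾ
  bounded-unique zero (suc n) = []ᴾ
  bounded-unique (suc m) n =
    UP.++⁺ (plainTop-unique m n n)
           (guard-unique (suc m ℕ.≤? n) (map-∷-unique (suc m , true) (plainTop-unique m n (n ∸ suc m))))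
           disjoint
    where
    disjoint : ∀ {x} → ¬ (x ∈ plainTop m n n ×
                           x ∈ guard (suc m ℕ.≤? n) (map ((suc m , true) ∷_) (plainTop m n (n ∸ suc m))))
    disjoint (p , q) with ∈-map-∷⁻ (proj₂ (∈-guard⁻ (suc m ℕ.≤? n) q))
    ... | _ , refl , _ with plainTop-sound m n n p
    ...   | _ , _ , (h ∷ᴬ _) with h refl
    ...     | ()

  plainTop-unique : ∀ m f n → Unique (plainTop m f n)
  plainTop-unique m zero n = bounded-unique m n
  plainTop-unique m (suc f) n =
    UP.++⁺ (bounded-unique m n)
           (guard-unique (suc m ℕ.≤? n) (map-∷-unique (suc m , false) (plainTop-unique m f (n ∸ suc m))))
           disjoint
    where
    disjoint : ∀ {x} → ¬ (x ∈ bounded m n ×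
                           x ∈ guard (suc m ℕ.≤? n) (map ((suc m , false) ∷_) (plainTop m f (n ∸ suc m))))
    disjoint (p , q) with ∈-map-∷⁻ (proj₂ (∈-guard⁻ (suc m ℕ.≤? n) q))
    ... | _ , refl , _ with bounded-sound m n p
    ...   | _ , (h ∷ᴬ _) = ℕP.<-irrefl refl h

∈-listsUpTo : ∀ {X : Set} (A : List X) m π → length π ≤ m → All (_∈ A) π → π ∈ listsUpTo A m
∈-listsUpTo A zero [] _ _ = here refl
∈-listsUpTo A (suc m) [] _ _ = here refl
∈-listsUpTo A (suc m) (a ∷ π) (s≤s le) (a∈A ∷ᴬ rest) =
  there (MP.∈-concatMap⁺ (λ a' → map (a' ∷_) (listsUpTo A m))
          (Any.map (λ { refl → MP.∈-map⁺ (a ∷_) (∈-listsUpTo A m π le rest) }) a∈A))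

∈-partsUpTo : ∀ n x b → 1 ≤ x → x ≤ n → (x , b) ∈ partsUpTo n
∈-partsUpTo n (suc k) b _ k<n =
  MP.∈-concatMap⁺ (λ k → (suc k , false) ∷ (suc k , true) ∷ []) (Any.map (λ { refl → either b }) (MP.∈-upTo⁺ k<n))
  where
  either : ∀ b → (suc k , b) ∈ (suc k , false) ∷ (suc k , true) ∷ []
  either false = here refl
  either true = there (here refl)

length≤partSum : ∀ π → AllPositive π → length π ≤ partSum π
length≤partSum [] [] = z≤n
length≤partSum (p ∷ π) (p≥1 ∷ pos) = ℕP.+-mono-≤ p≥1 (length≤partSum π pos)

part≤partSum : ∀ π → All (λ p → proj₁ p ≤ partSum π) π
part≤partSum [] = []ᴬ
part≤partSum (p ∷ π) =
  ℕP.m≤m+n (proj₁ p) (partSum π) ∷ᴬ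
  All.map (λ q → ℕP.≤-trans q (ℕP.m≤n+m (partSum π) (proj₁ p))) (part≤partSum π)

AllPositive⇒All : ∀ π → AllPositive π → All (λ p → 1 ≤ proj₁ p) π
AllPositive⇒All [] [] = []ᴬ
AllPositive⇒All (p ∷ π) (p≥1 ∷ pos) = p≥1 ∷ᴬ AllPositive⇒All π pos

∈-overpartitions⁺ : ∀ n π → IsOverpartition n π → π ∈ overpartitions n
∈-overpartitions⁺ n π ov@(pos , _ , sum) =
  MP.∈-filter⁺ (isOverpartition? n)
    (∈-listsUpTo (partsUpTo n) n π (subst (length π ≤_) sum (length≤partSum π pos))
       (All.zipWith (λ { {(x , b)} (x≥1 , x≤) → ∈-partsUpTo n x b x≥1 (subst (x ≤_) sum x≤) })
                    (AllPositive⇒All π pos , part≤partSum π)))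
    ov

∈-overpartitions⁻ : ∀ n π → π ∈ overpartitions n → IsOverpartition n π
∈-overpartitions⁻ n π q = proj₂ (MP.∈-filter⁻ (isOverpartition? n) {xs = listsUpTo (partsUpTo n) n} q)

overpartitions-unique : ∀ n → Unique (overpartitions n)
overpartitions-unique n = UP.filter⁺ (isOverpartition? n) (listsUpTo-unique (partsUpTo n) n (partsUpTo-unique n))

sumOver-overpartitions : ∀ g n → sumOver g (overpartitions n) ≡ sumOver g (bounded n n)
sumOver-overpartitions g n =
  sumOver-sameElements g (overpartitions-unique n) (bounded-unique n n)
    (λ {π} q → let ov = ∈-overpartitions⁻ n π q in
      bounded-complete n n π ov (All.map (λ {p} z → subst (proj₁ p ≤_) (proj₂ (proj₂ ov)) z) (part≤partSum π)))
    (λ {π} q → ∈-overpartitions⁺ n π (proj₁ (bounded-sound n n q)))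

plainTop-fuel : ∀ m f f' n → n ≤ f → n ≤ f' → plainTop m f n ≡ plainTop m f' n
plainTop-fuel m zero zero n _ _ = refl
plainTop-fuel m zero (suc f') zero _ _ with suc m ℕ.≤? 0
... | no _ = sym (LP.++-identityʳ (bounded m 0))
plainTop-fuel m (suc f) zero zero _ _ with suc m ℕ.≤? 0
... | no _ = LP.++-identityʳ (bounded m 0)
plainTop-fuel m (suc f) (suc f') n n≤f n≤f' with suc m ℕ.≤? n
... | no _ = refl
... | yes _ = cong (λ z → bounded m n ++ map ((suc m , false) ∷_) z)
                   (plainTop-fuel m f f' (n ∸ suc m) (shrink n≤f) (shrink n≤f'))
  where
  shrink : ∀ {f} → n ≤ suc f → n ∸ suc m ≤ f
  shrink n≤ = ℕP.≤-trans (ℕP.∸-monoʳ-≤ n (s≤s (z≤n {m}))) (ℕP.∸-monoˡ-≤ 1 n≤)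

boundedSum : (List Part → ℕ) → ℕ → ℕ → ℕ
boundedSum g m n = sumOver g (bounded m n)

plainTopSum : (List Part → ℕ) → ℕ → ℕ → ℕ
plainTopSum g m n = sumOver g (plainTop m n n)

ifDec : ∀ {P : Set} → Dec P → ℕ → ℕ
ifDec (yes _) k = k
ifDec (no _) k = 0

sumOver-guard : ∀ {A : Set} (g : A → ℕ) {P : Set} (d : Dec P) xs → sumOver g (guard d xs) ≡ ifDec d (sumOver g xs)
sumOver-guard g (yes _) xs = refl
sumOver-guard g (no _) xs = refl

plainTopSum-rec : ∀ g m n → plainTopSum g m n ≡
  boundedSum g m n ℕ.+ ifDec (suc m ℕ.≤? n) (plainTopSum (g ∘ ((suc m , false) ∷_)) m (n ∸ suc m))
plainTopSum-rec g m zero with suc m ℕ.≤? 0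
... | no _ = sym (ℕP.+-identityʳ _)
plainTopSum-rec g m (suc n) with suc m ℕ.≤? suc n
... | no _ = sumOver-++ g (bounded m (suc n)) []
... | yes _ =
  trans (sumOver-++ g (bounded m (suc n)) _)
        (cong (boundedSum g m (suc n) ℕ.+_)
              (trans (sumOver-map g ((suc m , false) ∷_) (plainTop m n (suc n ∸ suc m)))
                     (cong (sumOver (g ∘ ((suc m , false) ∷_)))
                           (plainTop-fuel m n (suc n ∸ suc m) (suc n ∸ suc m) (ℕP.m∸n≤m n m) ℕP.≤-refl))))

boundedSum-rec : ∀ g m n → boundedSum g (suc m) n ≡
  plainTopSum g m n ℕ.+ ifDec (suc m ℕ.≤? n) (plainTopSum (g ∘ ((suc m , true) ∷_)) m (n ∸ suc m))
boundedSum-rec g m n =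
  trans (sumOver-++ g (plainTop m n n) _)
        (cong (plainTopSum g m n ℕ.+_)
              (trans (sumOver-guard g (suc m ℕ.≤? n) _)
                     (cong (ifDec (suc m ℕ.≤? n))
                           (trans (sumOver-map g ((suc m , true) ∷_) (plainTop m n (n ∸ suc m)))
                                  (cong (sumOver (g ∘ ((suc m , true) ∷_)))
                                        (plainTop-fuel m n (n ∸ suc m) (n ∸ suc m) (ℕP.m∸n≤m n (suc m)) ℕP.≤-refl))))))

toSeries : (ℕ → ℕ) → Series
toSeries F n = + F n

q^-⊛-toSeries : ∀ v F n → (q^ v ⊛ toSeries F) n ≡ + ifDec (v ℕ.≤? n) (F (n ∸ v))
q^-⊛-toSeries v F n with v ℕ.≤? n
... | yes v≤n = trans (cong (q^ v ⊛ toSeries F) (sym (ℕP.m+[n∸m]≡n v≤n))) (q^-⊛-shift v (toSeries F) (n ∸ v))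
... | no v≰n = q^-⊛-below v (toSeries F) n (ℕP.≰⇒> v≰n)

boundedGF : (List Part → ℕ) → ℕ → Series
boundedGF g m = toSeries (boundedSum g m)

plainTopGF : (List Part → ℕ) → ℕ → Series
plainTopGF g m = toSeries (plainTopSum g m)

plainTopGF-rec : ∀ g m → plainTopGF g m ≗ boundedGF g m ⊕ q^ (suc m) ⊛ plainTopGF (g ∘ ((suc m , false) ∷_)) m
plainTopGF-rec g m n =
  trans (cong +_ (plainTopSum-rec g m n))
        (cong (ℤ._+_ (+ boundedSum g m n)) (sym (q^-⊛-toSeries (suc m) (plainTopSum (g ∘ ((suc m , false) ∷_)) m) n)))

boundedGF-rec : ∀ g m → boundedGF g (suc m) ≗ plainTopGF g m ⊕ q^ (suc m) ⊛ plainTopGF (g ∘ ((suc m , true) ∷_)) m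
boundedGF-rec g m n =
  trans (cong +_ (boundedSum-rec g m n))
        (cong (ℤ._+_ (+ plainTopSum g m n)) (sym (q^-⊛-toSeries (suc m) (plainTopSum (g ∘ ((suc m , true) ∷_)) m) n)))

plainTopGF-cong : ∀ {g g'} m → (∀ π → g π ≡ g' π) → plainTopGF g m ≗ plainTopGF g' m
plainTopGF-cong m e n = cong +_ (sumOver-cong (plainTop m n n) (λ x _ → e x))

boundedGF-zero : ∀ g m → (∀ π → PartsAtMost m π → g π ≡ 0) → boundedGF g m ≗ 𝟘
boundedGF-zero g m e n = cong +_ (sumOver-zero (bounded m n) (λ π q → e π (proj₂ (bounded-sound m n q))))

-- Multiplying by 1 - q^(m+1) clears the geometric series of plain copies of m + 1 that
-- plainTopGF adds; the overlined copy contributes the factor 1 + q^(m+1).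
boundedGF-suc : ∀ g m → (∀ b π → g ((suc m , b) ∷ π) ≡ g π) →
  boundedGF g (suc m) ⊛ 1-q^ (suc m) ≗ boundedGF g m ⊛ 1+q^ (suc m)
boundedGF-suc g m invariant = begin
    boundedGF g (suc m) ⊛ 1-q^ (suc m)
  ≈⟨ ⊛-congʳ (1-q^ (suc m)) (≗-trans (boundedGF-rec g m) (⊕-congˡ P (⊛-congˡ x (plainTopGF-cong m (invariant true))))) ⟩
    (P ⊕ x ⊛ P) ⊛ 1-q^ (suc m)
  ≈⟨ solve 2 (λ p y → (p :+ y :* p) :* (con (+ 1) :+ :- y) := (p :+ :- (y :* p)) :* (con (+ 1) :+ y))
             (λ _ → refl) P x ⟩
    (P ⊕ ⊝ (x ⊛ P)) ⊛ 1+q^ (suc m)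
  ≈⟨ ⊛-congʳ (1+q^ (suc m)) P-minus-shift ⟩
    boundedGF g m ⊛ 1+q^ (suc m)
  ∎
  where
  x P : Series
  x = q^ (suc m)
  P = plainTopGF g m
  P-minus-shift : P ⊕ ⊝ (x ⊛ P) ≗ boundedGF g m
  P-minus-shift =
    ≗-trans (⊕-congʳ (⊝ (x ⊛ P)) (≗-trans (plainTopGF-rec g m)
                                          (⊕-congˡ (boundedGF g m) (⊛-congˡ x (plainTopGF-cong m (invariant false))))))
            (solve 2 (λ G y → (G :+ y) :+ :- y := G) (λ _ → refl) (boundedGF g m) (x ⊛ P))

overpartitionGF : ℕ → Series
overpartitionGF = boundedGF (λ _ → 1)

overpartitionGF-suc : ∀ m → overpartitionGF (suc m) ⊛ 1-q^ (suc m) ≗ overpartitionGF m ⊛ 1+q^ (suc m)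
overpartitionGF-suc m = boundedGF-suc (λ _ → 1) m (λ _ _ → refl)

overpartitionGF-finPoch : ∀ m → overpartitionGF m ⊛ finPoch (+ 1) 1 1 m ≗ finPoch (- (+ 1)) 1 1 m
overpartitionGF-finPoch zero = ≗-trans (⊛-congʳ one (λ { zero → refl ; (suc n) → refl })) (𝟙-⊛ one)
overpartitionGF-finPoch (suc m) = begin
    G₊ ⊛ (finPoch (+ 1) 1 1 m ⊛ binom (- (+ 1)) (1 ℕ.+ 1 * m))
  ≈⟨ ⊛-congˡ G₊ (⊛-congˡ (finPoch (+ 1) 1 1 m)
                         (≗-trans (binom-1≗ (1 ℕ.+ 1 * m) (s≤s z≤n)) (≡⇒≗ (cong 1-q^_ e)))) ⟩
    G₊ ⊛ (finPoch (+ 1) 1 1 m ⊛ 1-q^ (suc m))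
  ≈⟨ solve 3 (λ g f o → g :* (f :* o) := (g :* o) :* f) (λ _ → refl) G₊ (finPoch (+ 1) 1 1 m) (1-q^ (suc m)) ⟩
    (G₊ ⊛ 1-q^ (suc m)) ⊛ finPoch (+ 1) 1 1 m
  ≈⟨ ⊛-congʳ (finPoch (+ 1) 1 1 m) (overpartitionGF-suc m) ⟩
    (overpartitionGF m ⊛ 1+q^ (suc m)) ⊛ finPoch (+ 1) 1 1 m
  ≈⟨ solve 3 (λ g o f → (g :* o) :* f := (g :* f) :* o) (λ _ → refl) (overpartitionGF m) (1+q^ (suc m)) (finPoch (+ 1) 1 1 m) ⟩
    (overpartitionGF m ⊛ finPoch (+ 1) 1 1 m) ⊛ 1+q^ (suc m)
  ≈⟨ ⊛-cong (overpartitionGF-finPoch m)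
            (≗-sym (≗-trans (binom+1≗ (1 ℕ.+ 1 * m) (s≤s z≤n)) (≡⇒≗ (cong 1+q^_ e)))) ⟩
    finPoch (- (+ 1)) 1 1 (suc m)
  ∎
  where
  G₊ : Series
  G₊ = overpartitionGF (suc m)
  e : 1 ℕ.+ 1 * m ≡ suc m
  e = cong suc (ℕP.*-identityˡ m)

overpartitionGF-stable : ∀ k t → overpartitionGF (t ℕ.+ k) ≈[ suc k ] overpartitionGF k
overpartitionGF-stable k zero = ≈-refl
overpartitionGF-stable k (suc t) =
  ≈-trans (≈-weaken (s≤s (ℕP.m≤n+m k t)) (step (t ℕ.+ k))) (overpartitionGF-stable k t)
  where
  step : ∀ m → overpartitionGF (suc m) ≈[ suc m ] overpartitionGF m
  step m =
    ≈-trans (≗⇒≈ (≗-sym (⊛-𝟙 (overpartitionGF (suc m)))))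
            (≈-trans (⊛-≈ {overpartitionGF (suc m)} ≈-refl (≈-sym (1-q^≈𝟙 (suc m))))
                     (≈-trans (≗⇒≈ (overpartitionGF-suc m))
                              (≈-trans (⊛-≈ {overpartitionGF m} ≈-refl (1+q^≈𝟙 (suc m)))
                                       (≗⇒≈ (⊛-𝟙 (overpartitionGF m))))))

sumOver-sumBelow : ∀ {A : Set} xs a (F : A → ℕ → ℕ) →
  sumOver (λ π → sumBelow a (F π)) xs ≡ sumBelow a (λ k → sumOver (λ π → F π k) xs)
sumOver-sumBelow [] a F = sym (sumBelow-zero a (λ j _ → refl))
sumOver-sumBelow (π ∷ xs) a F =
  trans (cong (sumBelow a (F π) ℕ.+_) (sumOver-sumBelow xs a F))
        (sym (sumBelow-distrib-+ a (F π) (λ k → sumOver (λ π' → F π' k) xs)))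

countNonOver-other : ∀ u v b π → v ≢ u → countNonOver u ((v , b) ∷ π) ≡ countNonOver u π
countNonOver-other u v false π v≢u rewrite ≢⇒≡ᵇ-false v u v≢u = refl
countNonOver-other u v true π v≢u = refl

countNonOver-self : ∀ v π → countNonOver v ((v , false) ∷ π) ≡ suc (countNonOver v π)
countNonOver-self v π rewrite ≡ᵇ-refl v = refl

countNonOver-above : ∀ m π → PartsAtMost m π → countNonOver (suc m) π ≡ 0
countNonOver-above m [] _ = refl
countNonOver-above m ((v , b) ∷ π) (v≤m ∷ᴬ le) =
  trans (countNonOver-other (suc m) v b π (λ e → ℕP.<-irrefl e (s≤s v≤m))) (countNonOver-above m π le)

sum-countNonOver≤length : ∀ k π → sumBelow k (λ j → countNonOver (suc j) π) ≤ length π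
sum-countNonOver≤length k [] = ℕP.≤-reflexive (sumBelow-zero k (λ j _ → refl))
sum-countNonOver≤length k ((y , false) ∷ π) =
  ℕP.≤-trans (ℕP.≤-reflexive (sumBelow-distrib-+ k (λ j → if y ≡ᵇ suc j then 1 else 0) (λ j → countNonOver (suc j) π)))
             (ℕP.+-mono-≤ (at-most-once y k) (sum-countNonOver≤length k π))
  where
  at-most-once : ∀ y k → sumBelow k (λ j → if y ≡ᵇ suc j then 1 else 0) ≤ 1
  at-most-once zero k = ℕP.≤-trans (ℕP.≤-reflexive (sumBelow-zero k (λ j _ → refl))) z≤n
  at-most-once (suc zero) zero = z≤n
  at-most-once (suc zero) (suc k) = ℕP.≤-reflexive (cong suc (sumBelow-zero k (λ j _ → refl)))
  at-most-once (suc (suc y)) zero = z≤n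
  at-most-once (suc (suc y)) (suc k) = at-most-once (suc y) k
sum-countNonOver≤length k ((y , true) ∷ π) = ℕP.≤-trans (sum-countNonOver≤length k π) (ℕP.n≤1+n (length π))

-- The Gauss identity in Q = q^r

module _ (r : ℕ) (r≥1 : 1 ≤ r) where

  infix 25 Q^_ 1-Q^_ 1+Q^_

  Q^_ 1-Q^_ 1+Q^_ : ℕ → Series
  Q^ k = q^ (r ℕ.* k)
  1-Q^ k = 1-q^ (r ℕ.* k)
  1+Q^ k = 1+q^ (r ℕ.* k)

  r*-mono : ∀ {a b} → a ≤ b → r ℕ.* a ≤ r ℕ.* b
  r*-mono = ℕP.*-monoʳ-≤ r

  n≤r*n : ∀ n → n ≤ r ℕ.* n
  n≤r*n n = ℕP.≤-trans (ℕP.≤-reflexive (sym (ℕP.*-identityˡ n))) (ℕP.*-monoˡ-≤ n r≥1)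

  2r≥1 : 1 ≤ 2 * r
  2r≥1 = ℕP.≤-trans r≥1 (ℕP.m≤m+n r (r ℕ.+ 0))

  Q^-+ : ∀ a b → Q^ a ⊛ Q^ b ≗ Q^ (a ℕ.+ b)
  Q^-+ a b = ≗-trans (q^-+ (r ℕ.* a) (r ℕ.* b)) (≡⇒≗ (cong q^_ (sym (ℕP.*-distribˡ-+ r a b))))

  Q^0 : Q^ 0 ≗ 𝟙
  Q^0 = ≗-trans (≡⇒≗ (cong q^_ (ℕP.*-zeroʳ r))) q^0

  Q^-cong : ∀ {a b} → a ≡ b → Q^ a ≗ Q^ b
  Q^-cong refl = ≗-refl

  1-Q^≈𝟙 : ∀ k → 1-Q^ k ≈[ r ℕ.* k ] 𝟙
  1-Q^≈𝟙 k = 1-q^≈𝟙 (r ℕ.* k)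

  -- In the notation (a;Q)ₙ = ∏_{j<n} (1 - a Qʲ): QPoch n = (Q;Q)ₙ, QPochNeg n = (-Q;Q)ₙ,
  -- QPochNeg₀ n = (-1;Q)ₙ, QPochEven n = (Q²;Q²)ₙ and QPochOdd n = (Q;Q²)ₙ.
  QPoch QPochNeg QPochNeg₀ QPochEven QPochOdd : ℕ → Series
  QPoch n = prodS n (λ i → 1-Q^ (suc i))
  QPochNeg n = prodS n (λ i → 1+Q^ (suc i))
  QPochNeg₀ n = prodS n 1+Q^_
  QPochEven n = prodS n (λ j → 1-Q^ (suc j ℕ.+ suc j))
  QPochOdd n = prodS n (λ j → 1-Q^ (suc (j ℕ.+ j)))

  QPoch-constant : ∀ n → QPoch n 0 ≡ + 1
  QPoch-constant n =
    prodS-constant n _ (λ i _ → 1-Q^≈𝟙 (suc i) 0 (ℕP.≤-trans (s≤s z≤n) (n≤r*n (suc i))))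

  QPoch-split : ∀ s d → QPoch (s ℕ.+ d) ≗ QPoch s ⊛ prodS d (λ i → 1-Q^ (suc (s ℕ.+ i)))
  QPoch-split s d = prodS-split s d (λ i → 1-Q^ (suc i))

  QPoch-tail≈𝟙 : ∀ s d → prodS d (λ i → 1-Q^ (suc (s ℕ.+ i))) ≈[ r ℕ.* suc s ] 𝟙
  QPoch-tail≈𝟙 s d = prodS-≈𝟙 d (λ i _ → ≈-weaken (r*-mono (s≤s (ℕP.m≤m+n s i))) (1-Q^≈𝟙 (suc (s ℕ.+ i))))

  QPochNeg⊛QPoch : ∀ N → QPochNeg N ⊛ QPoch N ≗ QPochEven N
  QPochNeg⊛QPoch N =
    ≗-trans (≗-sym (prodS-⊛ N (λ i → 1+Q^ (suc i)) (λ i → 1-Q^ (suc i))))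
            (prodS-cong N (λ j _ → ≗-trans (difference-of-squares (Q^ (suc j)))
                                            (⊕-congˡ 𝟙 (⊝-cong (Q^-+ (suc j) (suc j))))))
    where
    difference-of-squares : ∀ y → (𝟙 ⊕ y) ⊛ (𝟙 ⊕ ⊝ y) ≗ 𝟙 ⊕ ⊝ (y ⊛ y)
    difference-of-squares = solve 1 (λ y → (con (+ 1) :+ y) :* (con (+ 1) :+ :- y) := con (+ 1) :+ :- (y :* y)) (λ _ → refl)

  QPochEven⊛QPochOdd : ∀ N → QPochEven N ⊛ QPochOdd N ≗ QPoch (N ℕ.+ N)
  QPochEven⊛QPochOdd N =
    ≗-trans (⊛-comm (QPochEven N) (QPochOdd N))
            (≗-trans (≗-sym (prodS-⊛ N _ _))
                     (≗-trans (prodS-cong N (λ j _ → ⊛-congˡ (1-Q^ (suc (j ℕ.+ j)))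
                                                        (≡⇒≗ (cong (λ z → 1-Q^ (suc z)) (ℕP.+-suc j j)))))
                              (≗-sym (prodS-pairs N (λ i → 1-Q^ (suc i))))))

  QBinom : ℕ → ℕ → Series
  QBinom n zero = 𝟙
  QBinom zero (suc i) = 𝟘
  QBinom (suc n) (suc i) = QBinom n (suc i) ⊕ Q^ (n ∸ i) ⊛ QBinom n i

  QBinom-above : ∀ n i → n < i → QBinom n i ≗ 𝟘
  QBinom-above zero (suc i) _ = ≗-refl
  QBinom-above (suc n) (suc i) (s≤s n<i) k =
    trans (⊕-cong (QBinom-above n (suc i) (ℕP.m≤n⇒m≤1+n n<i)) (⊛-vanishʳ (Q^ (n ∸ i)) (QBinom-above n i n<i)) k)
          refl

  QBinom-diag : ∀ n → QBinom n n ≗ 𝟙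
  QBinom-diag zero = ≗-refl
  QBinom-diag (suc n) k =
    trans (⊕-cong (QBinom-above n (suc n) ℕP.≤-refl)
                  (≗-trans (⊛-cong {Q^ (n ∸ n)} {𝟙} (≗-trans (Q^-cong (ℕP.n∸n≡0 n)) Q^0) (QBinom-diag n))
                           (𝟙-⊛ 𝟙)) k)
          (ℤP.+-identityˡ (𝟙 k))

  QBinom-QPoch : ∀ j a → (QBinom (j ℕ.+ a) j ⊛ QPoch j) ⊛ QPoch a ≗ QPoch (j ℕ.+ a)
  QBinom-QPoch zero a = ≗-trans (⊛-congʳ (QPoch a) (𝟙-⊛ 𝟙)) (𝟙-⊛ (QPoch a))
  QBinom-QPoch (suc j) zero rewrite ℕP.+-identityʳ j =
    ≗-trans (⊛-𝟙 _) (≗-trans (⊛-congʳ (QPoch (suc j)) (QBinom-diag (suc j))) (𝟙-⊛ _))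
  QBinom-QPoch (suc j) (suc a) = begin
      ((B₁ ⊕ Q^ (n ∸ j) ⊛ B₀) ⊛ (Qj ⊛ 1-Q^ (suc j))) ⊛ (Qa ⊛ 1-Q^ (suc a))
    ≈⟨ ⊛-congʳ (Qa ⊛ 1-Q^ (suc a))
         (⊛-congʳ (Qj ⊛ 1-Q^ (suc j)) (⊕-congˡ B₁ (⊛-congʳ B₀ (Q^-cong (ℕP.m+n∸m≡n j (suc a)))))) ⟩
      ((B₁ ⊕ X ⊛ B₀) ⊛ (Qj ⊛ 1-Q^ (suc j))) ⊛ (Qa ⊛ 1-Q^ (suc a))
    ≈⟨ solve 6 (λ B₁ B₀ Qj Qa X Y →
          ((B₁ :+ X :* B₀) :* (Qj :* (con (+ 1) :+ :- Y))) :* (Qa :* (con (+ 1) :+ :- X))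
          := ((B₁ :* (Qj :* (con (+ 1) :+ :- Y))) :* Qa) :* (con (+ 1) :+ :- X)
             :+ (X :* (con (+ 1) :+ :- Y)) :* ((B₀ :* Qj) :* (Qa :* (con (+ 1) :+ :- X))))
          (λ _ → refl) B₁ B₀ Qj Qa X (Q^ (suc j)) ⟩
      ((B₁ ⊛ (Qj ⊛ 1-Q^ (suc j))) ⊛ Qa) ⊛ 1-Q^ (suc a) ⊕ (X ⊛ 1-Q^ (suc j)) ⊛ ((B₀ ⊛ Qj) ⊛ (Qa ⊛ 1-Q^ (suc a)))
    ≈⟨ ⊕-cong (⊛-congʳ (1-Q^ (suc a)) shorter-top) (⊛-congˡ (X ⊛ 1-Q^ (suc j)) (QBinom-QPoch j (suc a))) ⟩
      Qn ⊛ 1-Q^ (suc a) ⊕ (X ⊛ 1-Q^ (suc j)) ⊛ Qn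
    ≈⟨ solve 3 (λ Qn X Y → Qn :* (con (+ 1) :+ :- X) :+ (X :* (con (+ 1) :+ :- Y)) :* Qn
                         := Qn :* (con (+ 1) :+ :- (X :* Y))) (λ _ → refl) Qn X (Q^ (suc j)) ⟩
      Qn ⊛ (𝟙 ⊕ ⊝ (X ⊛ Q^ (suc j)))
    ≈⟨ ⊛-congˡ Qn (⊕-congˡ 𝟙 (⊝-cong (≗-trans (Q^-+ (suc a) (suc j)) (Q^-cong (ℕP.+-comm (suc a) (suc j)))))) ⟩
      QPoch (suc j ℕ.+ suc a)
    ∎
    where
    n : ℕ
    n = j ℕ.+ suc a
    B₁ B₀ Qj Qa Qn X : Series
    B₁ = QBinom n (suc j)
    B₀ = QBinom n j
    Qj = QPoch j
    Qa = QPoch a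
    Qn = QPoch n
    X = Q^ (suc a)
    shorter-top : (B₁ ⊛ (Qj ⊛ 1-Q^ (suc j))) ⊛ Qa ≗ Qn
    shorter-top = subst (λ m → (QBinom m (suc j) ⊛ (Qj ⊛ 1-Q^ (suc j))) ⊛ Qa ≗ QPoch m)
                        (sym (ℕP.+-suc j a)) (QBinom-QPoch (suc j) a)

  pascal′-rhs⊛QPoch : ∀ i a →
    (Q^ (suc i) ⊛ QBinom (i ℕ.+ a) (suc i) ⊕ QBinom (i ℕ.+ a) i) ⊛ (QPoch (suc i) ⊛ QPoch a) ≗ QPoch (suc i ℕ.+ a)
  pascal′-rhs⊛QPoch i zero rewrite ℕP.+-identityʳ i = begin
      (Q^ (suc i) ⊛ QBinom i (suc i) ⊕ QBinom i i) ⊛ (QPoch (suc i) ⊛ 𝟙)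
    ≈⟨ ⊛-cong (⊕-cong (⊛-vanishʳ (Q^ (suc i)) (QBinom-above i (suc i) ℕP.≤-refl)) (QBinom-diag i))
              (⊛-𝟙 (QPoch (suc i))) ⟩
      (𝟘 ⊕ 𝟙) ⊛ QPoch (suc i)
    ≈⟨ ⊛-congʳ (QPoch (suc i)) (λ k → ℤP.+-identityˡ (𝟙 k)) ⟩
      𝟙 ⊛ QPoch (suc i)
    ≈⟨ 𝟙-⊛ (QPoch (suc i)) ⟩
      QPoch (suc i)
    ∎
  pascal′-rhs⊛QPoch i (suc a) = begin
      (X ⊛ B₁ ⊕ B₀) ⊛ (QPoch (suc i) ⊛ (QPoch a ⊛ 1-Q^ (suc a)))
    ≈⟨ solve 7 (λ X B₁ B₀ Q O Qa Oa → (X :* B₁ :+ B₀) :* ((Q :* O) :* (Qa :* Oa))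
                  := (X :* Oa) :* ((B₁ :* (Q :* O)) :* Qa) :+ ((B₀ :* Q) :* (Qa :* Oa)) :* O)
               (λ _ → refl) X B₁ B₀ (QPoch i) (1-Q^ (suc i)) (QPoch a) (1-Q^ (suc a)) ⟩
      (X ⊛ 1-Q^ (suc a)) ⊛ ((B₁ ⊛ QPoch (suc i)) ⊛ QPoch a) ⊕ ((B₀ ⊛ QPoch i) ⊛ QPoch (suc a)) ⊛ 1-Q^ (suc i)
    ≈⟨ ⊕-cong (⊛-congˡ (X ⊛ 1-Q^ (suc a)) shorter-bottom) (⊛-congʳ (1-Q^ (suc i)) (QBinom-QPoch i (suc a))) ⟩
      (X ⊛ 1-Q^ (suc a)) ⊛ Qn ⊕ Qn ⊛ 1-Q^ (suc i)
    ≈⟨ solve 3 (λ X Y Q → (X :* (con (+ 1) :+ :- Y)) :* Q :+ Q :* (con (+ 1) :+ :- X)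
                        := Q :* (con (+ 1) :+ :- (X :* Y))) (λ _ → refl) X (Q^ (suc a)) Qn ⟩
      Qn ⊛ (𝟙 ⊕ ⊝ (X ⊛ Q^ (suc a)))
    ≈⟨ ⊛-congˡ Qn (⊕-congˡ 𝟙 (⊝-cong (Q^-+ (suc i) (suc a)))) ⟩
      QPoch (suc i ℕ.+ suc a)
    ∎
    where
    n : ℕ
    n = i ℕ.+ suc a
    X B₁ B₀ Qn : Series
    X = Q^ (suc i)
    B₁ = QBinom n (suc i)
    B₀ = QBinom n i
    Qn = QPoch n
    shorter-bottom : (B₁ ⊛ QPoch (suc i)) ⊛ QPoch a ≗ Qn
    shorter-bottom = subst (λ m → (QBinom m (suc i) ⊛ QPoch (suc i)) ⊛ QPoch a ≗ QPoch m)
                           (sym (ℕP.+-suc i a)) (QBinom-QPoch (suc i) a)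

  QBinom-pascal′ : ∀ n i → QBinom (suc n) (suc i) ≗ Q^ (suc i) ⊛ QBinom n (suc i) ⊕ QBinom n i
  QBinom-pascal′ n i with i ℕ.≤? n
  ... | yes i≤n = subst (λ m → QBinom (suc m) (suc i) ≗ Q^ (suc i) ⊛ QBinom m (suc i) ⊕ QBinom m i)
                        (ℕP.m+[n∸m]≡n i≤n) (via-QPoch (n ∸ i))
    where
    via-QPoch : ∀ a → QBinom (suc (i ℕ.+ a)) (suc i) ≗ Q^ (suc i) ⊛ QBinom (i ℕ.+ a) (suc i) ⊕ QBinom (i ℕ.+ a) i
    via-QPoch a =
      ⊛-cancelʳ {V = QPoch (suc i) ⊛ QPoch a} (cong₂ ℤ._*_ (QPoch-constant (suc i)) (QPoch-constant a))
        (≗-trans (≗-trans (≗-sym (⊛-assoc _ (QPoch (suc i)) (QPoch a))) (QBinom-QPoch (suc i) a))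
                 (≗-sym (pascal′-rhs⊛QPoch i a)))
  ... | no i≰n =
    ≗-trans (QBinom-above (suc n) (suc i) (s≤s n<i))
            (≗-sym (≗-trans (⊕-cong (⊛-vanishʳ (Q^ (suc i)) (QBinom-above n (suc i) (ℕP.m≤n⇒m≤1+n n<i)))
                                     (QBinom-above n i n<i))
                             (λ _ → refl)))
    where
    n<i : n < i
    n<i = ℕP.≰⇒> i≰n

  triangular : ℕ → ℕ
  triangular zero = 0
  triangular (suc k) = triangular k ℕ.+ k

  ≤-triangular : ∀ k → k ≤ triangular (suc k)
  ≤-triangular k = ℕP.m≤n+m k (triangular k)

  -- jacobiExp M i = (i - M)(i - M + 1)/2 computed over ℤ: the exponent of the i-th term of
  -- the finite Jacobi triple product centred at M.
  jacobiExp : ℕ → ℕ → ℕ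
  jacobiExp M i = triangular (M ∸ i) ℕ.+ triangular (suc (i ∸ M))

  jacobiExp-right : ∀ M d → jacobiExp M (M ℕ.+ d) ≡ triangular (suc d)
  jacobiExp-right M d =
    cong₂ ℕ._+_ (cong triangular (ℕP.m≤n⇒m∸n≡0 (ℕP.m≤m+n M d))) (cong (triangular ∘ suc) (ℕP.m+n∸m≡n M d))

  jacobiExp-left : ∀ N i → i ≤ N → jacobiExp (suc N) i ≡ triangular (suc (N ∸ i))
  jacobiExp-left N i i≤N rewrite ℕP.+-∸-assoc 1 i≤N | ℕP.m≤n⇒m∸n≡0 (ℕP.m≤n⇒m≤1+n i≤N) = ℕP.+-identityʳ _

  jacobiExp-suc : ∀ M i → jacobiExp M (suc i) ℕ.+ M ≡ jacobiExp M i ℕ.+ suc i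
  jacobiExp-suc M i with M ℕ.≤? i
  ... | yes M≤i =
    subst (λ i → jacobiExp M (suc i) ℕ.+ M ≡ jacobiExp M i ℕ.+ suc i) (ℕP.m+[n∸m]≡n M≤i) (right (i ∸ M))
    where
    right : ∀ d → jacobiExp M (suc (M ℕ.+ d)) ℕ.+ M ≡ jacobiExp M (M ℕ.+ d) ℕ.+ suc (M ℕ.+ d)
    right d =
      trans (cong (ℕ._+ M) (trans (cong (jacobiExp M) (sym (ℕP.+-suc M d))) (jacobiExp-right M (suc d))))
            (trans (shuffle (triangular d) d M) (cong (ℕ._+ suc (M ℕ.+ d)) (sym (jacobiExp-right M d))))
      where
      shuffle : ∀ t d M → (t ℕ.+ d ℕ.+ suc d) ℕ.+ M ≡ (t ℕ.+ d) ℕ.+ suc (M ℕ.+ d)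
      shuffle = NS.solve-∀
  ... | no M≰i =
    subst (λ M → jacobiExp M (suc i) ℕ.+ M ≡ jacobiExp M i ℕ.+ suc i) (ℕP.m+[n∸m]≡n (ℕP.≰⇒> M≰i)) (left (M ∸ suc i))
    where
    left : ∀ d → jacobiExp (suc (i ℕ.+ d)) (suc i) ℕ.+ suc (i ℕ.+ d) ≡ jacobiExp (suc (i ℕ.+ d)) i ℕ.+ suc i
    left zero rewrite ℕP.+-identityʳ i = cong (ℕ._+ suc i) (trans at-centre (sym below-centre))
      where
      at-centre : jacobiExp (suc i) (suc i) ≡ 0
      at-centre rewrite ℕP.n∸n≡0 i = refl
      below-centre : jacobiExp (suc i) i ≡ 0
      below-centre rewrite ℕP.+-∸-assoc 1 (ℕP.≤-refl {i}) | ℕP.n∸n≡0 i | ℕP.m≤n⇒m∸n≡0 (ℕP.n≤1+n i) = refl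
    left (suc d) =
      trans (cong (λ m → jacobiExp (suc m) (suc i) ℕ.+ suc m) (ℕP.+-suc i d))
            (trans (cong (ℕ._+ suc (suc (i ℕ.+ d))) (jacobi-left (suc i) d))
                   (trans (shuffle (triangular d) d i) (cong (ℕ._+ suc i) (sym (jacobi-left i (suc d))))))
      where
      jacobi-left : ∀ i d → jacobiExp (suc (i ℕ.+ d)) i ≡ triangular (suc d)
      jacobi-left i d = trans (jacobiExp-left (i ℕ.+ d) i (ℕP.m≤m+n i d)) (cong (triangular ∘ suc) (ℕP.m+n∸m≡n i d))
      shuffle : ∀ t d i → (t ℕ.+ d) ℕ.+ suc (suc (i ℕ.+ d)) ≡ ((t ℕ.+ d) ℕ.+ suc d) ℕ.+ suc i
      shuffle = NS.solve-∀

  jacobiExp-suc-zero : ∀ M → jacobiExp (suc M) 0 ≡ M ℕ.+ jacobiExp M 0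
  jacobiExp-suc-zero M rewrite ℕP.0∸n≡0 M | ℕP.0∸n≡0 (suc M) = shuffle (triangular M) M
    where
    shuffle : ∀ t M → t ℕ.+ M ℕ.+ 0 ≡ M ℕ.+ (t ℕ.+ 0)
    shuffle = NS.solve-∀

  jacobiExp-shift : ∀ M N j → j ≤ M ℕ.+ N → (M ℕ.+ N ∸ j) ℕ.+ jacobiExp M (suc j) ≡ suc N ℕ.+ jacobiExp M j
  jacobiExp-shift M N j j≤ =
    ℕP.+-cancelʳ-≡ j _ _
      (trans (swap₂₃ (M ℕ.+ N ∸ j) (jacobiExp M (suc j)) j)
      (trans (cong (ℕ._+ jacobiExp M (suc j)) (ℕP.m∸n+n≡m j≤))
      (trans (rotate M N (jacobiExp M (suc j)))
      (trans (cong (N ℕ.+_) (jacobiExp-suc M j))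
             (regroup N (jacobiExp M j) j)))))
    where
    swap₂₃ : ∀ a b c → (a ℕ.+ b) ℕ.+ c ≡ (a ℕ.+ c) ℕ.+ b
    swap₂₃ = NS.solve-∀
    rotate : ∀ a b c → (a ℕ.+ b) ℕ.+ c ≡ b ℕ.+ (c ℕ.+ a)
    rotate = NS.solve-∀
    regroup : ∀ a b c → a ℕ.+ (b ℕ.+ suc c) ≡ (suc a ℕ.+ b) ℕ.+ c
    regroup = NS.solve-∀

  jacobiSum : ℕ → ℕ → Series
  jacobiSum M n = sumS (suc n) (λ i → QBinom n i ⊛ Q^ (jacobiExp M i))

  Q^-⊛-exchange : ∀ a b c d B → a ℕ.+ b ≡ c ℕ.+ d → (Q^ a ⊛ B) ⊛ Q^ b ≗ Q^ c ⊛ (B ⊛ Q^ d)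
  Q^-⊛-exchange a b c d B eq = begin
      (Q^ a ⊛ B) ⊛ Q^ b
    ≈⟨ solve 3 (λ x B y → (x :* B) :* y := B :* (x :* y)) (λ _ → refl) (Q^ a) B (Q^ b) ⟩
      B ⊛ (Q^ a ⊛ Q^ b)
    ≈⟨ ⊛-congˡ B (≗-trans (Q^-+ a b) (≗-trans (Q^-cong eq) (≗-sym (Q^-+ c d)))) ⟩
      B ⊛ (Q^ c ⊛ Q^ d)
    ≈⟨ solve 3 (λ x B y → B :* (x :* y) := x :* (B :* y)) (λ _ → refl) (Q^ c) B (Q^ d) ⟩
      Q^ c ⊛ (B ⊛ Q^ d)
    ∎

  jacobiSum-diag : ∀ M → jacobiSum M M ≗ QPochNeg₀ M
  jacobiSum-diag zero k =
    trans (cong (ℤ._+_ ((𝟙 ⊛ Q^ 0) k)) (⊛-vanishˡ (Q^ (jacobiExp 0 1)) (λ _ → refl) k))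
          (trans (ℤP.+-identityʳ _) (≗-trans (𝟙-⊛ (Q^ 0)) Q^0 k))
  jacobiSum-diag (suc M) = begin
      jacobiSum (suc M) (suc M)
    ≈⟨ sumS-sucˡ (suc M) T ⟩
      T 0 ⊕ sumS (suc M) (λ j → T (suc j))
    ≈⟨ ⊕-congˡ (T 0) (sumS-cong (suc M) (λ j _ → pascal j)) ⟩
      T 0 ⊕ sumS (suc M) (λ j → Raised j ⊕ Lowered j)
    ≈⟨ ⊕-congˡ (T 0) (sumS-distrib-⊕ (suc M) Raised Lowered) ⟩
      T 0 ⊕ (sumS (suc M) Raised ⊕ jacobiSum M M)
    ≈⟨ ⊕-congˡ (T 0) (⊕-congʳ (jacobiSum M M) (sumS-last-𝟘 M Raised last-vanishes)) ⟩
      T 0 ⊕ (sumS M Raised ⊕ jacobiSum M M)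
    ≈⟨ ⊕-cong first-term (⊕-congʳ (jacobiSum M M) (sumS-cong M (λ j _ → raised-term j))) ⟩
      Q^ M ⊛ U 0 ⊕ (sumS M (λ j → Q^ M ⊛ U (suc j)) ⊕ jacobiSum M M)
    ≈⟨ solve 3 (λ a b c → a :+ (b :+ c) := (a :+ b) :+ c) (λ _ → refl)
               (Q^ M ⊛ U 0) (sumS M (λ j → Q^ M ⊛ U (suc j))) (jacobiSum M M) ⟩
      (Q^ M ⊛ U 0 ⊕ sumS M (λ j → Q^ M ⊛ U (suc j))) ⊕ jacobiSum M M
    ≈⟨ ⊕-congʳ (jacobiSum M M) (≗-sym (≗-trans (⊛-distribˡ-sumS (Q^ M) (suc M) U) (sumS-sucˡ M _))) ⟩
      Q^ M ⊛ jacobiSum M M ⊕ jacobiSum M M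
    ≈⟨ ⊕-cong (⊛-congˡ (Q^ M) (jacobiSum-diag M)) (jacobiSum-diag M) ⟩
      Q^ M ⊛ QPochNeg₀ M ⊕ QPochNeg₀ M
    ≈⟨ solve 2 (λ x e → x :* e :+ e := e :* (con (+ 1) :+ x)) (λ _ → refl) (Q^ M) (QPochNeg₀ M) ⟩
      QPochNeg₀ (suc M)
    ∎
    where
    T U Raised Lowered : ℕ → Series
    T i = QBinom (suc M) i ⊛ Q^ (jacobiExp (suc M) i)
    U i = QBinom M i ⊛ Q^ (jacobiExp M i)
    Raised j = (Q^ (suc j) ⊛ QBinom M (suc j)) ⊛ Q^ (jacobiExp M j)
    Lowered j = QBinom M j ⊛ Q^ (jacobiExp M j)
    pascal : ∀ j → T (suc j) ≗ Raised j ⊕ Lowered j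
    pascal j = ≗-trans (⊛-congʳ (Q^ (jacobiExp M j)) (QBinom-pascal′ M j)) (⊛-distribʳ (Q^ (jacobiExp M j)) _ _)
    last-vanishes : Raised (suc M) ≗ 𝟘
    last-vanishes =
      ⊛-vanishˡ (Q^ (jacobiExp M (suc M))) (⊛-vanishʳ (Q^ (suc (suc M))) (QBinom-above M (suc (suc M)) (ℕP.n≤1+n (suc M))))
    first-term : T 0 ≗ Q^ M ⊛ U 0
    first-term =
      ≗-trans (𝟙-⊛ _)
              (≗-trans (Q^-cong (jacobiExp-suc-zero M))
                       (≗-trans (≗-sym (Q^-+ M (jacobiExp M 0))) (⊛-congˡ (Q^ M) (≗-sym (𝟙-⊛ _)))))
    raised-term : ∀ j → Raised j ≗ Q^ M ⊛ U (suc j)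
    raised-term j =
      Q^-⊛-exchange (suc j) (jacobiExp M j) M (jacobiExp M (suc j)) (QBinom M (suc j))
        (sym (trans (ℕP.+-comm M _) (trans (jacobiExp-suc M j) (ℕP.+-comm (jacobiExp M j) (suc j)))))

  jacobiSum-suc : ∀ M N → jacobiSum M (suc (M ℕ.+ N)) ≗ 1+Q^ (suc N) ⊛ jacobiSum M (M ℕ.+ N)
  jacobiSum-suc M N = begin
      jacobiSum M (suc n)
    ≈⟨ sumS-sucˡ (suc n) T ⟩
      T 0 ⊕ sumS (suc n) (λ j → T (suc j))
    ≈⟨ ⊕-congˡ (T 0) (sumS-cong (suc n) (λ j _ → ⊛-distribʳ (Q^ (jacobiExp M (suc j))) _ _)) ⟩
      T 0 ⊕ sumS (suc n) (λ j → U (suc j) ⊕ Shifted j)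
    ≈⟨ ⊕-congˡ (T 0) (sumS-distrib-⊕ (suc n) (U ∘ suc) Shifted) ⟩
      T 0 ⊕ (sumS (suc n) (U ∘ suc) ⊕ sumS (suc n) Shifted)
    ≈⟨ solve 3 (λ a b c → a :+ (b :+ c) := (a :+ b) :+ c) (λ _ → refl)
               (T 0) (sumS (suc n) (U ∘ suc)) (sumS (suc n) Shifted) ⟩
      (T 0 ⊕ sumS (suc n) (U ∘ suc)) ⊕ sumS (suc n) Shifted
    ≈⟨ ⊕-cong (≗-trans (≗-sym (sumS-sucˡ (suc n) U)) (sumS-last-𝟘 (suc n) U last-vanishes))
              (sumS-cong (suc n) (λ j _ → shifted-term j)) ⟩
      jacobiSum M n ⊕ sumS (suc n) (λ j → Q^ (suc N) ⊛ U j)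
    ≈⟨ ⊕-congˡ (jacobiSum M n) (≗-sym (⊛-distribˡ-sumS (Q^ (suc N)) (suc n) U)) ⟩
      jacobiSum M n ⊕ Q^ (suc N) ⊛ jacobiSum M n
    ≈⟨ solve 2 (λ F x → F :+ x :* F := (con (+ 1) :+ x) :* F) (λ _ → refl) (jacobiSum M n) (Q^ (suc N)) ⟩
      1+Q^ (suc N) ⊛ jacobiSum M n
    ∎
    where
    n : ℕ
    n = M ℕ.+ N
    T U Shifted : ℕ → Series
    T i = QBinom (suc n) i ⊛ Q^ (jacobiExp M i)
    U i = QBinom n i ⊛ Q^ (jacobiExp M i)
    Shifted j = (Q^ (n ∸ j) ⊛ QBinom n j) ⊛ Q^ (jacobiExp M (suc j))
    last-vanishes : U (suc (suc n)) ≗ 𝟘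
    last-vanishes = ⊛-vanishˡ (Q^ (jacobiExp M (suc (suc n)))) (QBinom-above n (suc (suc n)) (ℕP.n≤1+n (suc n)))
    shifted-term : ∀ j → Shifted j ≗ Q^ (suc N) ⊛ U j
    shifted-term j with j ℕ.≤? n
    ... | yes j≤n = Q^-⊛-exchange (n ∸ j) (jacobiExp M (suc j)) (suc N) (jacobiExp M j) (QBinom n j) (jacobiExp-shift M N j j≤n)
    ... | no j≰n = ≗-trans (⊛-vanishˡ _ (⊛-vanishʳ _ above)) (≗-sym (⊛-vanishʳ (Q^ (suc N)) (⊛-vanishˡ _ above)))
      where
      above : QBinom n j ≗ 𝟘
      above = QBinom-above n j (ℕP.≰⇒> j≰n)

  jacobiSum-product : ∀ M N → jacobiSum M (M ℕ.+ N) ≗ QPochNeg N ⊛ QPochNeg₀ M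
  jacobiSum-product M zero =
    ≗-trans (≡⇒≗ (cong (jacobiSum M) (ℕP.+-identityʳ M))) (≗-trans (jacobiSum-diag M) (≗-sym (𝟙-⊛ (QPochNeg₀ M))))
  jacobiSum-product M (suc N) = begin
      jacobiSum M (M ℕ.+ suc N)
    ≡⟨ cong (jacobiSum M) (ℕP.+-suc M N) ⟩
      jacobiSum M (suc (M ℕ.+ N))
    ≈⟨ jacobiSum-suc M N ⟩
      1+Q^ (suc N) ⊛ jacobiSum M (M ℕ.+ N)
    ≈⟨ ⊛-congˡ (1+Q^ (suc N)) (jacobiSum-product M N) ⟩
      1+Q^ (suc N) ⊛ (QPochNeg N ⊛ QPochNeg₀ M)
    ≈⟨ solve 3 (λ o e f → o :* (e :* f) := (e :* o) :* f) (λ _ → refl) (1+Q^ (suc N)) (QPochNeg N) (QPochNeg₀ M) ⟩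
      QPochNeg (suc N) ⊛ QPochNeg₀ M
    ∎

  triangularSum : ℕ → Series
  triangularSum N = sumS N (λ k → Q^ (triangular (suc k)))

  QBinom⊛QPoch≈𝟙 : ∀ B p q N → (B ⊛ QPoch p) ⊛ QPoch q ≗ QPoch (p ℕ.+ q) → p ≤ N → N ≤ q →
    B ⊛ QPoch N ≈[ r ℕ.* suc p ] 𝟙
  QBinom⊛QPoch≈𝟙 B p q N B-identity p≤N N≤q =
    ⊛-cancelʳ-≈ {B ⊛ QPoch N} {𝟙} {QPoch q} (r ℕ.* suc p) (QPoch-constant q)
      (≈-trans (≗⇒≈ regroup)
               (≈-trans (⊛-≈ {QPoch q ⊛ Tail q p} {QPoch q ⊛ 𝟙} {Tail p d} {𝟙}
                               (⊛-≈ {QPoch q} ≈-refl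
                                    (≈-weaken (r*-mono (s≤s (ℕP.≤-trans p≤N N≤q))) (QPoch-tail≈𝟙 q p)))
                               (QPoch-tail≈𝟙 p d))
                        (≗⇒≈ (≗-trans (⊛-𝟙 (QPoch q ⊛ 𝟙))
                                      (≗-trans (⊛-𝟙 (QPoch q)) (≗-sym (𝟙-⊛ (QPoch q))))))))
    where
    d : ℕ
    d = N ∸ p
    Tail : ℕ → ℕ → Series
    Tail s d = prodS d (λ i → 1-Q^ (suc (s ℕ.+ i)))
    regroup : (B ⊛ QPoch N) ⊛ QPoch q ≗ (QPoch q ⊛ Tail q p) ⊛ Tail p d
    regroup = begin
        (B ⊛ QPoch N) ⊛ QPoch q
      ≡⟨ cong (λ k → (B ⊛ QPoch k) ⊛ QPoch q) (sym (ℕP.m+[n∸m]≡n p≤N)) ⟩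
        (B ⊛ QPoch (p ℕ.+ d)) ⊛ QPoch q
      ≈⟨ ⊛-congʳ (QPoch q) (⊛-congˡ B (QPoch-split p d)) ⟩
        (B ⊛ (QPoch p ⊛ Tail p d)) ⊛ QPoch q
      ≈⟨ solve 4 (λ B P R Q → (B :* (P :* R)) :* Q := ((B :* P) :* Q) :* R) (λ _ → refl) B (QPoch p) (Tail p d) (QPoch q) ⟩
        ((B ⊛ QPoch p) ⊛ QPoch q) ⊛ Tail p d
      ≈⟨ ⊛-congʳ (Tail p d) (≗-trans B-identity (≗-trans (≡⇒≗ (cong QPoch (ℕP.+-comm p q))) (QPoch-split q p))) ⟩
        (QPoch q ⊛ Tail q p) ⊛ Tail p d
      ∎

  term≈Q^ : ∀ e B p N → B ⊛ QPoch N ≈[ r ℕ.* suc p ] 𝟙 → suc N ≤ e ℕ.+ suc p →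
    (B ⊛ Q^ e) ⊛ QPoch N ≈[ r ℕ.* suc N ] Q^ e
  term≈Q^ e B p N B≈𝟙 N<e+p+1 =
    ≈-trans (≗⇒≈ (solve 3 (λ B x Q → (B :* x) :* Q := x :* (B :* Q)) (λ _ → refl) B (Q^ e) (QPoch N)))
            (≈-trans (≈-weaken precision (q^-⊛-≈ (r ℕ.* e) B≈𝟙)) (≗⇒≈ (⊛-𝟙 (Q^ e))))
    where
    precision : r ℕ.* suc N ≤ r ℕ.* e ℕ.+ r ℕ.* suc p
    precision = ℕP.≤-trans (r*-mono N<e+p+1) (ℕP.≤-reflexive (ℕP.*-distribˡ-+ r e (suc p)))

  centralTerm : ℕ → ℕ → Series
  centralTerm N i = (QBinom (suc N ℕ.+ N) i ⊛ Q^ (jacobiExp (suc N) i)) ⊛ QPoch N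

  jacobiSum-central-halves : ∀ N →
    jacobiSum (suc N) (suc N ℕ.+ N) ⊛ QPoch N ≗ sumS N (centralTerm N) ⊕ sumS N (λ j → centralTerm N (suc N ℕ.+ j))
  jacobiSum-central-halves N = begin
      jacobiSum (suc N) m ⊛ QPoch N
    ≈⟨ ⊛-distribʳ-sumS (suc m) _ (QPoch N) ⟩
      sumS (suc m) (centralTerm N)
    ≡⟨ cong (λ k → sumS k (centralTerm N)) (sym term-count) ⟩
      sumS (N ℕ.+ suc (suc N)) (centralTerm N)
    ≈⟨ sumS-split N (suc N) (centralTerm N) ⟩
      sumS N (centralTerm N) ⊕ sumS (suc N) (λ j → centralTerm N (suc N ℕ.+ j))
    ≈⟨ ⊕-congˡ (sumS N (centralTerm N)) (sumS-last-𝟘 N (λ j → centralTerm N (suc N ℕ.+ j)) last-vanishes) ⟩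
      sumS N (centralTerm N) ⊕ sumS N (λ j → centralTerm N (suc N ℕ.+ j))
    ∎
    where
    m : ℕ
    m = suc N ℕ.+ N
    term-count : N ℕ.+ suc (suc N) ≡ suc m
    term-count = trans (ℕP.+-suc N (suc N)) (cong suc (ℕP.+-comm N (suc N)))
    last-vanishes : centralTerm N (suc N ℕ.+ suc N) ≗ 𝟘
    last-vanishes =
      ⊛-vanishˡ (QPoch N) (⊛-vanishˡ _ (QBinom-above m (suc N ℕ.+ suc N) (s≤s (ℕP.≤-reflexive (sym (ℕP.+-suc N N))))))

  lower-half≈triangularSum : ∀ N → sumS N (centralTerm N) ≈[ r ℕ.* suc N ] triangularSum N
  lower-half≈triangularSum N =
    ≈-trans (sumS-≈ N term≈)
            (≗⇒≈ (≗-trans (sumS-reverse N (λ i → Q^ (jacobiExp (suc N) i)))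
                          (sumS-cong N (λ k k≤N → Q^-cong (trans (jacobiExp-left N (N ∸ k) (ℕP.m∸n≤m N k))
                                                                 (cong (triangular ∘ suc) (ℕP.m∸[m∸n]≡n k≤N)))))))
    where
    m : ℕ
    m = suc N ℕ.+ N
    term≈ : ∀ i → i ≤ N → centralTerm N i ≈[ r ℕ.* suc N ] Q^ (jacobiExp (suc N) i)
    term≈ i i≤N =
      term≈Q^ (jacobiExp (suc N) i) (QBinom m i) i N
        (QBinom⊛QPoch≈𝟙 (QBinom m i) i (m ∸ i) N identity i≤N N≤m-i) exponent
      where
      identity : (QBinom m i ⊛ QPoch i) ⊛ QPoch (m ∸ i) ≗ QPoch (i ℕ.+ (m ∸ i))
      identity = subst (λ z → (QBinom z i ⊛ QPoch i) ⊛ QPoch (m ∸ i) ≗ QPoch (i ℕ.+ (m ∸ i)))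
                       (ℕP.m+[n∸m]≡n (ℕP.≤-trans i≤N (ℕP.m≤n+m N (suc N)))) (QBinom-QPoch i (m ∸ i))
      N≤m-i : N ≤ m ∸ i
      N≤m-i = ℕP.≤-trans (ℕP.≤-reflexive (sym (ℕP.m+n∸m≡n N N)))
                         (ℕP.≤-trans (ℕP.∸-monoʳ-≤ (N ℕ.+ N) i≤N) (ℕP.∸-monoˡ-≤ i (ℕP.n≤1+n (N ℕ.+ N))))
      exponent : suc N ≤ jacobiExp (suc N) i ℕ.+ suc i
      exponent = subst (λ z → suc N ≤ z ℕ.+ suc i) (sym (jacobiExp-left N i i≤N))
        (ℕP.≤-trans (ℕP.≤-reflexive (trans (cong suc (sym (ℕP.m∸n+n≡m i≤N))) (sym (ℕP.+-suc (N ∸ i) i))))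
                    (ℕP.+-monoˡ-≤ (suc i) (≤-triangular (N ∸ i))))

  upper-half≈triangularSum : ∀ N → sumS N (λ j → centralTerm N (suc N ℕ.+ j)) ≈[ r ℕ.* suc N ] triangularSum N
  upper-half≈triangularSum N = sumS-≈ N term≈
    where
    m : ℕ
    m = suc N ℕ.+ N
    term≈ : ∀ j → j ≤ N → centralTerm N (suc N ℕ.+ j) ≈[ r ℕ.* suc N ] Q^ (triangular (suc j))
    term≈ j j≤N =
      ≈-trans (term≈Q^ (jacobiExp (suc N) i) (QBinom m i) a N
                 (QBinom⊛QPoch≈𝟙 (QBinom m i) a i N identity (ℕP.m∸n≤m N j) N≤i) exponent)
              (≗⇒≈ (Q^-cong (jacobiExp-right (suc N) j)))
      where
      i a : ℕ
      i = suc N ℕ.+ j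
      a = N ∸ j
      i+a≡m : i ℕ.+ a ≡ m
      i+a≡m = trans (ℕP.+-assoc (suc N) j (N ∸ j)) (cong (suc N ℕ.+_) (ℕP.m+[n∸m]≡n j≤N))
      identity : (QBinom m i ⊛ QPoch a) ⊛ QPoch i ≗ QPoch (a ℕ.+ i)
      identity =
        ≗-trans (solve 3 (λ B P Q → (B :* P) :* Q := (B :* Q) :* P) (λ _ → refl) (QBinom m i) (QPoch a) (QPoch i))
                (≗-trans (subst (λ z → (QBinom z i ⊛ QPoch i) ⊛ QPoch a ≗ QPoch z) i+a≡m (QBinom-QPoch i a))
                         (≡⇒≗ (cong QPoch (trans (sym i+a≡m) (ℕP.+-comm i a)))))
      N≤i : N ≤ i
      N≤i = ℕP.≤-trans (ℕP.n≤1+n N) (ℕP.m≤m+n (suc N) j)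
      exponent : suc N ≤ jacobiExp (suc N) i ℕ.+ suc a
      exponent = subst (λ z → suc N ≤ z ℕ.+ suc a) (sym (jacobiExp-right (suc N) j))
        (ℕP.≤-trans (ℕP.≤-reflexive (trans (cong suc (sym (ℕP.m+[n∸m]≡n j≤N))) (sym (ℕP.+-suc j (N ∸ j)))))
                    (ℕP.+-monoˡ-≤ (suc a) (≤-triangular j)))

  -- The finite Jacobi product at its centre: (-1;Q)_{N+1} = 2 (-Q;Q)_N.
  jacobiSum-central : ∀ N →
    jacobiSum (suc N) (suc N ℕ.+ N) ⊛ QPoch N ≗ (𝟙 ⊕ 𝟙) ⊛ ((QPochNeg N ⊛ QPochNeg N) ⊛ QPoch N)
  jacobiSum-central N = begin
      jacobiSum (suc N) (suc N ℕ.+ N) ⊛ QPoch N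
    ≈⟨ ⊛-congʳ (QPoch N) (jacobiSum-product (suc N) N) ⟩
      (QPochNeg N ⊛ QPochNeg₀ (suc N)) ⊛ QPoch N
    ≈⟨ ⊛-congʳ (QPoch N) (⊛-congˡ (QPochNeg N) (prodS-split 1 N 1+Q^_)) ⟩
      (QPochNeg N ⊛ ((𝟙 ⊛ 1+Q^ 0) ⊛ QPochNeg N)) ⊛ QPoch N
    ≈⟨ ⊛-congʳ (QPoch N) (⊛-congˡ (QPochNeg N)
                                  (⊛-congʳ (QPochNeg N) (≗-trans (𝟙-⊛ (1+Q^ 0)) (⊕-congˡ 𝟙 Q^0)))) ⟩
      (QPochNeg N ⊛ ((𝟙 ⊕ 𝟙) ⊛ QPochNeg N)) ⊛ QPoch N
    ≈⟨ solve 3 (λ e t q → (e :* (t :* e)) :* q := t :* ((e :* e) :* q)) (λ _ → refl) (QPochNeg N) (𝟙 ⊕ 𝟙) (QPoch N) ⟩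
      (𝟙 ⊕ 𝟙) ⊛ ((QPochNeg N ⊛ QPochNeg N) ⊛ QPoch N)
    ∎

  triangularSum≈ : ∀ N → triangularSum N ≈[ r ℕ.* suc N ] (QPochNeg N ⊛ QPochNeg N) ⊛ QPoch N
  triangularSum≈ N =
    ≈-sym (2⊛-cancel-≈ (≈-trans (≗⇒≈ (≗-sym (jacobiSum-central N)))
                                (≈-trans (≗⇒≈ (jacobiSum-central-halves N))
                                         (≈-trans (⊕-≈ (lower-half≈triangularSum N) (upper-half≈triangularSum N))
                                                  (≗⇒≈ (solve 1 (λ T → T :+ T := (con (+ 1) :+ con (+ 1)) :* T)
                                                                (λ _ → refl) (triangularSum N)))))))

  gauss-truncated : ∀ N → triangularSum N ⊛ QPochOdd N ≈[ r ℕ.* suc N ] QPochEven N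
  gauss-truncated N =
    ≈-trans (⊛-≈ {triangularSum N} {(QPochNeg N ⊛ QPochNeg N) ⊛ QPoch N} {QPochOdd N} (triangularSum≈ N) ≈-refl)
            (≈-trans (≗⇒≈ regroup)
                     (≈-trans (⊛-≈ {QPochNeg N} ≈-refl (⊛-≈ {QPoch N} ≈-refl (QPoch-tail≈𝟙 N N)))
                              (≗⇒≈ (≗-trans (⊛-congˡ (QPochNeg N) (⊛-𝟙 (QPoch N))) (QPochNeg⊛QPoch N)))))
    where
    regroup : ((QPochNeg N ⊛ QPochNeg N) ⊛ QPoch N) ⊛ QPochOdd N ≗
              QPochNeg N ⊛ (QPoch N ⊛ prodS N (λ i → 1-Q^ (suc (N ℕ.+ i))))
    regroup = begin
        ((QPochNeg N ⊛ QPochNeg N) ⊛ QPoch N) ⊛ QPochOdd N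
      ≈⟨ solve 4 (λ e f q o → ((e :* f) :* q) :* o := e :* ((f :* q) :* o)) (λ _ → refl)
                 (QPochNeg N) (QPochNeg N) (QPoch N) (QPochOdd N) ⟩
        QPochNeg N ⊛ ((QPochNeg N ⊛ QPoch N) ⊛ QPochOdd N)
      ≈⟨ ⊛-congˡ (QPochNeg N) (≗-trans (⊛-congʳ (QPochOdd N) (QPochNeg⊛QPoch N))
                                        (≗-trans (QPochEven⊛QPochOdd N) (QPoch-split N N))) ⟩
        QPochNeg N ⊛ (QPoch N ⊛ prodS N (λ i → 1-Q^ (suc (N ℕ.+ i))))
      ∎

  -- mexExceeds π k is 1 when each of 1, …, k occurs at least r times non-overlined in π,
  -- i.e. when the least r-gap of π exceeds k, and 0 otherwise.
  mexExceeds : List Part → ℕ → ℕ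
  mexExceeds π zero = 1
  mexExceeds π (suc k) = if countNonOver (suc k) π <ᵇ r then 0 else mexExceeds π k

  mexExceeds-∷-above : ∀ k v b π → k < v → mexExceeds ((v , b) ∷ π) k ≡ mexExceeds π k
  mexExceeds-∷-above zero v b π _ = refl
  mexExceeds-∷-above (suc k) v b π k<v
    rewrite countNonOver-other (suc k) v b π (ℕP.<⇒≢ k<v ∘ sym)
          | mexExceeds-∷-above k v b π (ℕP.<-trans (ℕP.n<1+n k) k<v) = refl

  mexExceeds-zero-upward : ∀ π k → mexExceeds π k ≡ 0 → ∀ j → mexExceeds π (j ℕ.+ k) ≡ 0
  mexExceeds-zero-upward π k e zero = e
  mexExceeds-zero-upward π k e (suc j) with countNonOver (suc (j ℕ.+ k)) π <ᵇ r
  ... | true = refl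
  ... | false = mexExceeds-zero-upward π k e j

  mexExceeds⇒r≤count : ∀ π k → mexExceeds π k ≢ 0 → ∀ j → j < k → r ≤ countNonOver (suc j) π
  mexExceeds⇒r≤count π (suc k) ≢0 j j<k with countNonOver (suc k) π <ᵇ r in eq
  ... | true = ⊥-elim (≢0 refl)
  ... | false with j ℕ.≟ k
  ...   | yes refl = ℕP.≮⇒≥ (λ p → subst Data.Bool.T eq (ℕP.<⇒<ᵇ p))
  ...   | no j≢k = mexExceeds⇒r≤count π k ≢0 j (ℕP.≤∧≢⇒< (ℕP.≤-pred j<k) j≢k)

  mexExceeds-beyond-length : ∀ π j → suc (length π) ≤ j → mexExceeds π j ≡ 0
  mexExceeds-beyond-length π j len<j with mexExceeds π j ℕ.≟ 0
  ... | yes e = e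
  ... | no ≢0 = ⊥-elim (ℕP.<-irrefl refl (ℕP.≤-trans len<j j≤length))
    where
    j≤length : j ≤ length π
    j≤length = ℕP.≤-trans (≤-sumBelow j _ (λ i i<j → ℕP.≤-trans r≥1 (mexExceeds⇒r≤count π j ≢0 i i<j)))
                          (sum-countNonOver≤length j π)

  mexSearch≡ : ∀ fuel k π → mexExceeds π k ≡ 1 →
    mexSearch r π (suc k) fuel ≡ suc k ℕ.+ sumBelow fuel (λ j → mexExceeds π (suc j ℕ.+ k))
  mexSearch≡ zero k π _ = sym (ℕP.+-identityʳ (suc k))
  mexSearch≡ (suc fuel) k π e with countNonOver (suc k) π <ᵇ r in eq
  ... | true =
    sym (trans (cong (suc k ℕ.+_) (sumBelow-zero fuel (λ j _ →
                  trans (cong (mexExceeds π) (sym (ℕP.+-suc (suc j) k))) (mexExceeds-zero-upward π (suc k) stops (suc j)))))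
               (ℕP.+-identityʳ (suc k)))
    where
    stops : mexExceeds π (suc k) ≡ 0
    stops rewrite eq = refl
  ... | false =
    trans (mexSearch≡ fuel (suc k) π continues)
          (trans (cong (suc (suc k) ℕ.+_) (sumBelow-cong fuel (λ j _ → cong (mexExceeds π) (ℕP.+-suc (suc j) k))))
                 (trans (sym (ℕP.+-suc (suc k) _))
                        (cong (λ z → suc k ℕ.+ (z ℕ.+ sumBelow fuel (λ j → mexExceeds π (suc (suc j) ℕ.+ k)))) (sym e))))
    where
    continues : mexExceeds π (suc k) ≡ 1
    continues rewrite eq = e

  mexbar≡sumBelow : ∀ π n → length π ≤ n → mexbar r π ≡ sumBelow (suc n) (mexExceeds π)
  mexbar≡sumBelow π n len≤n =
    trans (mexSearch≡ (suc ℓ) 0 π refl)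
          (trans (cong (1 ℕ.+_) (sumBelow-cong (suc ℓ) (λ j _ → cong (mexExceeds π) (ℕP.+-identityʳ (suc j)))))
                 (trans (trans (cong (λ z → sumBelow z (mexExceeds π)) (ℕP.+-comm 1 (suc ℓ)))
                               (sumBelow-extend (suc ℓ) 1 (mexExceeds π) (mexExceeds-beyond-length π)))
                        (sym (trans (cong (λ z → sumBelow z (mexExceeds π)) (sym (ℕP.m+[n∸m]≡n (s≤s len≤n))))
                                    (sumBelow-extend (suc ℓ) (suc n ∸ suc ℓ) (mexExceeds π) (mexExceeds-beyond-length π))))))
    where
    ℓ : ℕ
    ℓ = length π

  σmexbar≡ : ∀ n → σmexbar r n ≡ sumBelow (suc n) (λ k → boundedSum (λ π → mexExceeds π k) n n)
  σmexbar≡ n =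
    trans (sumOver-overpartitions (mexbar r) n)
          (trans (sumOver-cong (bounded n n) (λ π q → mexbar≡sumBelow π n (length≤n π q)))
                 (sumOver-sumBelow (bounded n n) (suc n) mexExceeds))
    where
    length≤n : ∀ π → π ∈ bounded n n → length π ≤ n
    length≤n π q with proj₁ (bounded-sound n n q)
    ... | pos , _ , sum = subst (length π ≤_) sum (length≤partSum π pos)

  -- topWeight m r π is mexExceeds π (suc m); lowering t peels the plain copies of m + 1
  -- off one at a time.
  topWeight : ℕ → ℕ → List Part → ℕ
  topWeight m t π = if countNonOver (suc m) π <ᵇ t then 0 else mexExceeds π m

  topWeight-∷-plain : ∀ m t π → topWeight m (suc t) ((suc m , false) ∷ π) ≡ topWeight m t π
  topWeight-∷-plain m t π rewrite countNonOver-self (suc m) π | mexExceeds-∷-above m (suc m) false π ℕP.≤-refl = refl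

  topWeight-∷-overlined : ∀ m t π → topWeight m t ((suc m , true) ∷ π) ≡ topWeight m t π
  topWeight-∷-overlined m t π rewrite mexExceeds-∷-above m (suc m) true π ℕP.≤-refl = refl

  topWeight-bounded : ∀ m t π → PartsAtMost m π → topWeight m (suc t) π ≡ 0
  topWeight-bounded m t π le rewrite countNonOver-above m π le = refl

  mexExceedsGF : ℕ → ℕ → Series
  mexExceedsGF k = boundedGF (λ π → mexExceeds π k)

  topGF : ℕ → ℕ → Series
  topGF m t = plainTopGF (topWeight m t) m

  topGF-suc : ∀ m t → topGF m (suc t) ≗ q^ (suc m) ⊛ topGF m t
  topGF-suc m t =
    ≗-trans (plainTopGF-rec (topWeight m (suc t)) m)
            (≗-trans (⊕-congʳ (q^ (suc m) ⊛ plainTopGF (topWeight m (suc t) ∘ ((suc m , false) ∷_)) m)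
                              (boundedGF-zero (topWeight m (suc t)) m (topWeight-bounded m t)))
                     (≗-trans (λ n → ℤP.+-identityˡ _)
                              (⊛-congˡ (q^ (suc m)) (plainTopGF-cong m (topWeight-∷-plain m t)))))

  topGF≗ : ∀ m t → topGF m t ≗ q^ (t ℕ.* suc m) ⊛ topGF m 0
  topGF≗ m zero = ≗-sym (≗-trans (⊛-congʳ (topGF m 0) q^0) (𝟙-⊛ (topGF m 0)))
  topGF≗ m (suc t) =
    ≗-trans (topGF-suc m t)
            (≗-trans (⊛-congˡ (q^ (suc m)) (topGF≗ m t))
                     (≗-trans (≗-sym (⊛-assoc (q^ (suc m)) (q^ (t ℕ.* suc m)) (topGF m 0)))
                              (⊛-congʳ (topGF m 0) (q^-+ (suc m) (t ℕ.* suc m)))))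

  topGF-zero : ∀ m → topGF m 0 ⊛ 1-q^ (suc m) ≗ mexExceedsGF m m
  topGF-zero m = begin
      H ⊛ 1-q^ (suc m)
    ≈⟨ solve 2 (λ h y → h :* (con (+ 1) :+ :- y) := h :+ :- (y :* h)) (λ _ → refl) H (q^ (suc m)) ⟩
      H ⊕ ⊝ (q^ (suc m) ⊛ H)
    ≈⟨ ⊕-congʳ (⊝ (q^ (suc m) ⊛ H)) unfold ⟩
      (mexExceedsGF m m ⊕ q^ (suc m) ⊛ H) ⊕ ⊝ (q^ (suc m) ⊛ H)
    ≈⟨ solve 2 (λ a b → (a :+ b) :+ :- b := a) (λ _ → refl) (mexExceedsGF m m) (q^ (suc m) ⊛ H) ⟩
      mexExceedsGF m m
    ∎
    where
    H : Series
    H = topGF m 0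
    unfold : H ≗ mexExceedsGF m m ⊕ q^ (suc m) ⊛ H
    unfold = ≗-trans (plainTopGF-rec (topWeight m 0) m)
                     (⊕-congˡ (boundedGF (topWeight m 0) m)
                              (⊛-congˡ (q^ (suc m)) (plainTopGF-cong m (λ π → mexExceeds-∷-above m (suc m) false π ℕP.≤-refl))))

  mexExceedsGF-diag-suc : ∀ m →
    mexExceedsGF (suc m) (suc m) ⊛ 1-q^ (suc m) ≗ 1+q^ (suc m) ⊛ (q^ (r ℕ.* suc m) ⊛ mexExceedsGF m m)
  mexExceedsGF-diag-suc m = begin
      mexExceedsGF (suc m) (suc m) ⊛ 1-q^ (suc m)
    ≈⟨ ⊛-congʳ (1-q^ (suc m)) (≗-trans (boundedGF-rec (topWeight m r) m)
                                       (⊕-congˡ (topGF m r) (⊛-congˡ x (plainTopGF-cong m (topWeight-∷-overlined m r))))) ⟩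
      (topGF m r ⊕ x ⊛ topGF m r) ⊛ 1-q^ (suc m)
    ≈⟨ ⊛-congʳ (1-q^ (suc m)) (⊕-cong (topGF≗ m r) (⊛-congˡ x (topGF≗ m r))) ⟩
      (P ⊛ H ⊕ x ⊛ (P ⊛ H)) ⊛ 1-q^ (suc m)
    ≈⟨ solve 3 (λ p h y → (p :* h :+ y :* (p :* h)) :* (con (+ 1) :+ :- y)
                        := (con (+ 1) :+ y) :* (p :* (h :* (con (+ 1) :+ :- y)))) (λ _ → refl) P H x ⟩
      1+q^ (suc m) ⊛ (P ⊛ (H ⊛ 1-q^ (suc m)))
    ≈⟨ ⊛-congˡ (1+q^ (suc m)) (⊛-congˡ P (topGF-zero m)) ⟩
      1+q^ (suc m) ⊛ (P ⊛ mexExceedsGF m m)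
    ∎
    where
    x P H : Series
    x = q^ (suc m)
    P = q^ (r ℕ.* suc m)
    H = topGF m 0

  mexExceedsGF≗ : ∀ m k → k ≤ m → mexExceedsGF k m ≗ Q^ (triangular (suc k)) ⊛ overpartitionGF m
  mexExceedsGF≗ zero zero _ = ≗-sym (≗-trans (⊛-congʳ (overpartitionGF 0) Q^0) (𝟙-⊛ (overpartitionGF 0)))
  mexExceedsGF≗ (suc m) k k≤ with k ℕ.≤? m
  ... | yes k≤m = ⊛-cancelʳ {V = 1-q^ (suc m)} refl (begin
      mexExceedsGF k (suc m) ⊛ 1-q^ (suc m)
    ≈⟨ boundedGF-suc (λ π → mexExceeds π k) m (λ b π → mexExceeds-∷-above k (suc m) b π (s≤s k≤m)) ⟩
      mexExceedsGF k m ⊛ 1+q^ (suc m)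
    ≈⟨ ⊛-congʳ (1+q^ (suc m)) (mexExceedsGF≗ m k k≤m) ⟩
      (M ⊛ overpartitionGF m) ⊛ 1+q^ (suc m)
    ≈⟨ ⊛-assoc M (overpartitionGF m) (1+q^ (suc m)) ⟩
      M ⊛ (overpartitionGF m ⊛ 1+q^ (suc m))
    ≈⟨ ⊛-congˡ M (≗-sym (overpartitionGF-suc m)) ⟩
      M ⊛ (overpartitionGF (suc m) ⊛ 1-q^ (suc m))
    ≈⟨ ≗-sym (⊛-assoc M (overpartitionGF (suc m)) (1-q^ (suc m))) ⟩
      (M ⊛ overpartitionGF (suc m)) ⊛ 1-q^ (suc m)
    ∎)
    where
    M : Series
    M = Q^ (triangular (suc k))
  ... | no k≰m with ℕP.≤-antisym k≤ (ℕP.≰⇒> k≰m)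
  ...   | refl = ⊛-cancelʳ {V = 1-q^ (suc m)} refl (begin
      mexExceedsGF (suc m) (suc m) ⊛ 1-q^ (suc m)
    ≈⟨ mexExceedsGF-diag-suc m ⟩
      1+q^ (suc m) ⊛ (Q^ (suc m) ⊛ mexExceedsGF m m)
    ≈⟨ ⊛-congˡ (1+q^ (suc m)) (⊛-congˡ (Q^ (suc m)) (mexExceedsGF≗ m m ℕP.≤-refl)) ⟩
      1+q^ (suc m) ⊛ (Q^ (suc m) ⊛ (Q^ (triangular (suc m)) ⊛ overpartitionGF m))
    ≈⟨ solve 4 (λ o p q g → o :* (p :* (q :* g)) := (p :* q) :* (g :* o)) (λ _ → refl)
               (1+q^ (suc m)) (Q^ (suc m)) (Q^ (triangular (suc m))) (overpartitionGF m) ⟩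
      (Q^ (suc m) ⊛ Q^ (triangular (suc m))) ⊛ (overpartitionGF m ⊛ 1+q^ (suc m))
    ≈⟨ ⊛-cong (≗-trans (Q^-+ (suc m) (triangular (suc m))) (Q^-cong (ℕP.+-comm (suc m) (triangular (suc m)))))
              (≗-sym (overpartitionGF-suc m)) ⟩
      Q^ (triangular (suc (suc m))) ⊛ (overpartitionGF (suc m) ⊛ 1-q^ (suc m))
    ≈⟨ ≗-sym (⊛-assoc (Q^ (triangular (suc (suc m)))) (overpartitionGF (suc m)) (1-q^ (suc m))) ⟩
      (Q^ (triangular (suc (suc m))) ⊛ overpartitionGF (suc m)) ⊛ 1-q^ (suc m)
    ∎)

  σmexbarGF : Series
  σmexbarGF n = + σmexbar r n

  σmexbarGF≡ : ∀ n → σmexbarGF n ≡ (triangularSum n ⊛ overpartitionGF n) n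
  σmexbarGF≡ n =
    trans (cong +_ (σmexbar≡ n))
          (trans (+-sumBelow≡sumTo n _)
                 (trans (sum-cong n (λ k k≤n → mexExceedsGF≗ n k k≤n n))
                        (sym (⊛-distribʳ-sumS n (λ k → Q^ (triangular (suc k))) (overpartitionGF n) n))))

  triangularSum-stable : ∀ k t → triangularSum (t ℕ.+ k) ≈[ suc k ] triangularSum k
  triangularSum-stable k zero = ≈-refl
  triangularSum-stable k (suc t) =
    ≈-trans (≈-weaken (s≤s (ℕP.m≤n+m k t)) (step (t ℕ.+ k))) (triangularSum-stable k t)
    where
    step : ∀ m → triangularSum (suc m) ≈[ suc m ] triangularSum m
    step m j p =
      trans (cong (ℤ._+_ (triangularSum m j))
                  (q^≈𝟘 (r ℕ.* triangular (suc (suc m))) j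
                        (ℕP.<-≤-trans p (ℕP.≤-trans (≤-triangular (suc m)) (n≤r*n (triangular (suc (suc m))))))))
            (ℤP.+-identityʳ _)

  σmexbarGF≈ : ∀ n → σmexbarGF ≈[ suc n ] triangularSum n ⊛ overpartitionGF n
  σmexbarGF≈ n k k≤n =
    trans (σmexbarGF≡ k)
          (sym (subst (λ z → (triangularSum z ⊛ overpartitionGF z) k ≡ (triangularSum k ⊛ overpartitionGF k) k)
                      (ℕP.m∸n+n≡m (ℕP.≤-pred k≤n))
                      (⊛-≈ {triangularSum (n ∸ k ℕ.+ k)} {triangularSum k}
                           (triangularSum-stable k (n ∸ k)) (overpartitionGF-stable k (n ∸ k)) k ℕP.≤-refl)))

  QPochOdd≗finPoch : ∀ J → finPoch (+ 1) r (2 * r) J ≗ QPochOdd J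
  QPochOdd≗finPoch J =
    ≗-trans (finPoch-prodS (+ 1) r (2 * r) J)
            (prodS-cong J (λ j _ → ≗-trans (binom-1≗ (r ℕ.+ 2 * r * j) (ℕP.≤-trans r≥1 (ℕP.m≤m+n r _)))
                                            (≡⇒≗ (cong 1-q^_ (exponent r j)))))
    where
    exponent : ∀ r j → r ℕ.+ 2 * r * j ≡ r ℕ.* suc (j ℕ.+ j)
    exponent = NS.solve-∀

  QPochEven≗finPoch : ∀ J → finPoch (+ 1) (2 * r) (2 * r) J ≗ QPochEven J
  QPochEven≗finPoch J =
    ≗-trans (finPoch-prodS (+ 1) (2 * r) (2 * r) J)
            (prodS-cong J (λ j _ → ≗-trans (binom-1≗ (2 * r ℕ.+ 2 * r * j) (ℕP.≤-trans 2r≥1 (ℕP.m≤m+n (2 * r) _)))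
                                            (≡⇒≗ (cong 1-q^_ (exponent r j)))))
    where
    exponent : ∀ r j → 2 * r ℕ.+ 2 * r * j ≡ r ℕ.* (suc j ℕ.+ suc j)
    exponent = NS.solve-∀

  numerator denominator : Series
  numerator = poch (- (+ 1)) 1 1 ⊛ poch (+ 1) (2 * r) (2 * r)
  denominator = poch (+ 1) 1 1 ⊛ poch (+ 1) r (2 * r)

  -- Every coefficient is settled by truncating at precision n + 1, where all infinite
  -- products may be replaced by finite ones and the Gauss identity holds for triangularSum n.
  σmexbarGF⊛denominator : σmexbarGF ⊛ denominator ≗ numerator
  σmexbarGF⊛denominator n = agree n ℕP.≤-refl
    where
    T G E₋ E₊ Odd : Series
    T = triangularSum n
    G = overpartitionGF n
    E₋ = finPoch (- (+ 1)) 1 1 n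
    E₊ = finPoch (+ 1) 1 1 n
    Odd = finPoch (+ 1) r (2 * r) n
    regroup : (T ⊛ G) ⊛ (E₊ ⊛ Odd) ≗ E₋ ⊛ (T ⊛ QPochOdd n)
    regroup = begin
        (T ⊛ G) ⊛ (E₊ ⊛ Odd)
      ≈⟨ solve 4 (λ t g p o → (t :* g) :* (p :* o) := (g :* p) :* (t :* o)) (λ _ → refl) T G E₊ Odd ⟩
        (G ⊛ E₊) ⊛ (T ⊛ Odd)
      ≈⟨ ⊛-cong (overpartitionGF-finPoch n) (⊛-congˡ T (QPochOdd≗finPoch n)) ⟩
        E₋ ⊛ (T ⊛ QPochOdd n)
      ∎
    agree : σmexbarGF ⊛ denominator ≈[ suc n ] numerator
    agree =
      ≈-trans (⊛-≈ {σmexbarGF} (σmexbarGF≈ n)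
                   (⊛-≈ {poch (+ 1) 1 1} (poch≈finPoch (+ 1) 1 1 (s≤s z≤n) (s≤s z≤n) n)
                                         (poch≈finPoch (+ 1) r (2 * r) r≥1 2r≥1 n)))
      (≈-trans (≗⇒≈ regroup)
      (≈-trans (⊛-≈ {E₋} ≈-refl (≈-weaken (n≤r*n (suc n)) (gauss-truncated n)))
      (≈-trans (≗⇒≈ (⊛-congˡ E₋ (≗-sym (QPochEven≗finPoch n))))
               (≈-sym (⊛-≈ {poch (- (+ 1)) 1 1} (poch≈finPoch (- (+ 1)) 1 1 (s≤s z≤n) (s≤s z≤n) n)
                                                (poch≈finPoch (+ 1) (2 * r) (2 * r) 2r≥1 2r≥1 n))))))

theorem1p4 : (r : ℕ) → 1 ≤ r → (n : ℕ) →
    + σmexbar r n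
    ≡ ((poch (- (+ 1)) 1 1 ⊛ poch (+ 1) (2 * r) (2 * r))
    ⊘ (poch (+ 1) 1 1 ⊛ poch (+ 1) r (2 * r))) n
theorem1p4 r r≥1 n =
  sym (⊘-unique (numerator r r≥1) (denominator r r≥1) (σmexbarGF r r≥1) refl (σmexbarGF⊛denominator r r≥1) n)
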